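{- Let $n>2$ be an integer. Let $G_2$ be the induced subgraph of the comaximal graph $\Gamma(\mathbb{Z}_n)$ on the set of nonzero non-units of $\mathbb{Z}_n$, i.e. on $\{a\in\mathbb{Z}_n: a\neq 0,\ \gcd(a,n)\neq 1\}$. Then the Laplacian characteristic polynomial of $\Gamma(\mathbb{Z}_n)$ is $$\mu(\Gamma(\mathbb{Z}_n),x)=x\,(x-n)^{\phi(n)}\,\mu(G_2,x-\phi(n)),$$ where $\phi$ is Euler's totient function.
   Context: The comaximal graph $\Gamma(\mathbb{Z}_n)$ has vertex set $\mathbb{Z}_n=\{0,1,\dots,n-1\}$, distinct $x,y$ adjacent iff $\langle x\rangle+\langle y\rangle=\mathbb{Z}_n$. For a graph $G$, $L(G)=D(G)-A(G)$ is its Laplacian matrix ($D(G)$ the diagonal degree matrix, $A(G)$ the adjacency matrix), and $\mu(G,x)=\det(xI-L(G))$ is its (Laplacian) characteristic polynomial. If $G_2$ has no vertices (which happens when $n$ is prime), $\mu(G_2,x)$ is taken to be $1$. -}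

module Defs where

open import Data.Bool using (Bool; true; false; _∧_; not; if_then_else_)
open import Data.Nat as ℕ using (ℕ; zero; suc; _%_; _≡ᵇ_)
open import Data.Nat.GCD using (gcd)
open import Data.Integer as ℤ using (ℤ; +_; -_)
open import Data.List as L using (List; []; _∷_; upTo; filterᵇ; length; lookup; foldr; map)
open import Data.Bool.ListAction using (any)
open import Data.Fin as F using (Fin; punchIn; toℕ)
open import Relation.Binary.PropositionalEquality using (_≡_)
open import Relation.Nullary.Decidable using (does)
open import Data.Nat.Properties using (_≟_)

-- Polynomials over ℤ as coefficient lists (lowest degree first).

Poly : Set
Poly = List ℤ

coeff : Poly → ℕ → ℤ
coeff []       _       = + 0
coeff (a ∷ p)  zero    = a
coeff (a ∷ p)  (suc k) = coeff p k

infix 4 _≈P_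
_≈P_ : Poly → Poly → Set
p ≈P q = ∀ k → coeff p k ≡ coeff q k

constP : ℤ → Poly
constP a = a ∷ []

X : Poly
X = + 0 ∷ + 1 ∷ []

infixl 6 _+P_ _-P_
infixl 7 _*P_ _·P_
infixr 8 _^P_

_+P_ : Poly → Poly → Poly
[]      +P q       = q
(a ∷ p) +P []      = a ∷ p
(a ∷ p) +P (b ∷ q) = (a ℤ.+ b) ∷ (p +P q)

_·P_ : ℤ → Poly → Poly
c ·P p = map (c ℤ.*_) p

negP : Poly → Poly
negP p = (- (+ 1)) ·P p

_-P_ : Poly → Poly → Poly
p -P q = p +P negP q

_*P_ : Poly → Poly → Poly
[]      *P q = []
(a ∷ p) *P q = (a ·P q) +P (+ 0 ∷ (p *P q))

_^P_ : Poly → ℕ → Poly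
p ^P zero  = constP (+ 1)
p ^P suc k = p *P (p ^P k)

_∘P_ : Poly → Poly → Poly
p ∘P q = foldr (λ a acc → constP a +P (q *P acc)) [] p

sign : ℕ → ℤ
sign zero          = + 1
sign (suc zero)    = - (+ 1)
sign (suc (suc k)) = sign k

sumFin : (m : ℕ) → (Fin m → Poly) → Poly
sumFin zero    f = []
sumFin (suc m) f = f F.zero +P sumFin m (λ i → f (F.suc i))

det : (m : ℕ) → (Fin m → Fin m → Poly) → Poly
det zero    M = constP (+ 1)
det (suc m) M =
  sumFin (suc m) (λ j →
    sign (toℕ j) ·P (M F.zero j *P det m (λ r c → M (F.suc r) (punchIn j c))))

count : {A : Set} → (A → Bool) → List A → ℕ
count P []       = 0
count P (a ∷ as) = if P a then suc (count P as) else count P as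

-- μ(G, x) = det(xI - L(G)),  L = D - A, for the graph on vertex list vs
-- (vertices vs[i]) with adjacency adj (assumed irreflexive & symmetric).
lapCharPoly : (vs : List ℕ) → (ℕ → ℕ → Bool) → Poly
lapCharPoly vs adj = det (length vs) entry
  where
    v : Fin (length vs) → ℕ
    v = lookup vs
    deg : Fin (length vs) → ℕ
    deg i = count (adj (v i)) vs
    δ : Fin (length vs) → Fin (length vs) → Bool
    δ i j = toℕ i ≡ᵇ toℕ j
    entry : Fin (length vs) → Fin (length vs) → Poly
    entry i j =
      ((if δ i j then X else []) -P (if δ i j then constP (+ deg i) else []))
        +P (if adj (v i) (v j) then constP (+ 1) else [])

-- For modulus n = suc m: is 1 ∈ ⟨x⟩ + ⟨y⟩ in ℤ_n, i.e. are there
-- a, b ∈ ℤ_n with a x + b y ≡ 1 (mod n)?  (This is ⟨x⟩ + ⟨y⟩ = ℤ_n.)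
-- Decided by finite search over a, b ∈ {0, …, n-1}.
idealSumIsWhole : (m : ℕ) → ℕ → ℕ → Bool
idealSumIsWhole m x y =
  any (λ a → any (λ b → ((a ℕ.* x ℕ.+ b ℕ.* y) % suc m) ≡ᵇ (1 % suc m))
                 (upTo (suc m))) (upTo (suc m))

-- adjacency in Γ(ℤ_n): distinct x, y with ⟨x⟩ + ⟨y⟩ = ℤ_n
-- (n = 0 is never used; there we return false)
comaximalAdj : ℕ → ℕ → ℕ → Bool
comaximalAdj zero    x y = false
comaximalAdj (suc m) x y = not (x ≡ᵇ y) ∧ idealSumIsWhole m x y

vertsΓ : ℕ → List ℕ
vertsΓ n = upTo n

vertsG₂ : ℕ → List ℕ
vertsG₂ n = filterᵇ (λ a → not (a ≡ᵇ 0) ∧ not (gcd a n ≡ᵇ 1)) (upTo n)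

φ : ℕ → ℕ
φ n = count (λ k → gcd k n ≡ᵇ 1) (map suc (upTo n))

μΓ : ℕ → Poly
μΓ n = lapCharPoly (vertsΓ n) (comaximalAdj n)

μG₂ : ℕ → Poly
μG₂ n = lapCharPoly (vertsG₂ n) (comaximalAdj n)

-- Write A = xI − L for the Laplacian L of Γ(ℤₙ). Every row of A sums to x, so adding all
-- columns to the first one and then clearing the first row gives det A = x · det H, where H is
-- indexed by the nonzero residues and H(r, j) = A(r, j) − A(0, j). A unit u is adjacent to every
-- other vertex, including 0, so column u of H is (x − n) times the u-th unit vector; expanding
-- along these φ(n) columns leaves H on the nonzero non-units. There H agrees with A, since 0 is
-- adjacent to no non-unit, and every non-unit has degree φ(n) plus its degree in G₂; hence this
-- block is the matrix of μ(G₂, ·) evaluated at x − φ(n).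

module Submission where

open import Algebra.Bundles using (CommutativeRing)
open import Data.Nat using (ℕ)

module Polynomials where
  open import Defs
  open import Data.Nat using (ℕ; zero; suc)
  open import Data.Integer as ℤ using (ℤ; +_; -_)
  import Data.Integer.Properties as ℤ
  open import Data.Integer.Tactic.RingSolver using (solve-∀)
  open import Data.List using (List; []; _∷_)
  open import Data.Product using (_,_)
  open import Relation.Binary.PropositionalEquality
  open import Algebra.Bundles using (CommutativeRing)
  open import Algebra.Morphism.Structures using (module RingMorphisms)
  open import Level using (0ℓ)

  -- ≈P wrapped in a record, so that both polynomials can be inferred from a proof.
  infix 4 _≋_
  record _≋_ (p q : Poly) : Set where
    constructor mk≋
    field ≋⇒≈P : p ≈P q
  open _≋_ public

  coeff-+P : ∀ p q k → coeff (p +P q) k ≡ coeff p k ℤ.+ coeff q k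
  coeff-+P []      q       k       = sym (ℤ.+-identityˡ _)
  coeff-+P (a ∷ p) []      k       = sym (ℤ.+-identityʳ _)
  coeff-+P (a ∷ p) (b ∷ q) zero    = refl
  coeff-+P (a ∷ p) (b ∷ q) (suc k) = coeff-+P p q k

  coeff-·P : ∀ a p k → coeff (a ·P p) k ≡ a ℤ.* coeff p k
  coeff-·P a []      k       = sym (ℤ.*-zeroʳ a)
  coeff-·P a (x ∷ p) zero    = refl
  coeff-·P a (x ∷ p) (suc k) = coeff-·P a p k

  ≋-refl : ∀ {p} → p ≋ p
  ≋-refl = mk≋ λ _ → refl

  ≋-sym : ∀ {p q} → p ≋ q → q ≋ p
  ≋-sym e = mk≋ λ k → sym (≋⇒≈P e k)

  ≋-trans : ∀ {p q r} → p ≋ q → q ≋ r → p ≋ r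
  ≋-trans e f = mk≋ λ k → trans (≋⇒≈P e k) (≋⇒≈P f k)

  ≋-reflexive : ∀ {p q} → p ≡ q → p ≋ q
  ≋-reflexive refl = ≋-refl

  +P-cong : ∀ {p p′ q q′} → p ≋ p′ → q ≋ q′ → p +P q ≋ p′ +P q′
  +P-cong {p} {p′} {q} {q′} e f = mk≋ λ k →
    trans (coeff-+P p q k) (trans (cong₂ ℤ._+_ (≋⇒≈P e k) (≋⇒≈P f k)) (sym (coeff-+P p′ q′ k)))

  ·P-cong : ∀ a {p q} → p ≋ q → a ·P p ≋ a ·P q
  ·P-cong a {p} {q} e = mk≋ λ k →
    trans (coeff-·P a p k) (trans (cong (a ℤ.*_) (≋⇒≈P e k)) (sym (coeff-·P a q k)))

  ∷-cong : ∀ {a b p q} → a ≡ b → p ≋ q → a ∷ p ≋ b ∷ q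
  ∷-cong a≡b e = mk≋ λ { zero → a≡b ; (suc k) → ≋⇒≈P e k }

  +P-comm : ∀ p q → p +P q ≋ q +P p
  +P-comm p q = mk≋ λ k →
    trans (coeff-+P p q k) (trans (ℤ.+-comm (coeff p k) (coeff q k)) (sym (coeff-+P q p k)))

  +P-assoc : ∀ p q r → (p +P q) +P r ≋ p +P (q +P r)
  +P-assoc p q r = mk≋ λ k → begin
    coeff ((p +P q) +P r) k               ≡⟨ trans (coeff-+P (p +P q) r k) (cong (ℤ._+ _) (coeff-+P p q k)) ⟩
    coeff p k ℤ.+ coeff q k ℤ.+ coeff r k   ≡⟨ ℤ.+-assoc (coeff p k) _ _ ⟩
    coeff p k ℤ.+ (coeff q k ℤ.+ coeff r k) ≡⟨ trans (coeff-+P p (q +P r) k) (cong (λ z → coeff p k ℤ.+ z) (coeff-+P q r k)) ⟨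
    coeff (p +P (q +P r)) k               ∎
    where open ≡-Reasoning

  +P-identityʳ : ∀ p → p +P [] ≋ p
  +P-identityʳ p = mk≋ λ k → trans (coeff-+P p [] k) (ℤ.+-identityʳ _)

  negP-inverseˡ : ∀ p → negP p +P p ≋ []
  negP-inverseˡ p = mk≋ λ k →
    trans (coeff-+P (negP p) p k) (trans (cong (ℤ._+ coeff p k) (coeff-·P (- + 1) p k)) (-1*x+x≡0 (coeff p k)))
    where -1*x+x≡0 : ∀ x → - + 1 ℤ.* x ℤ.+ x ≡ + 0
          -1*x+x≡0 = solve-∀

  ·P-distrib-+P : ∀ a p q → a ·P (p +P q) ≋ a ·P p +P a ·P q
  ·P-distrib-+P a p q = mk≋ λ k → begin
    coeff (a ·P (p +P q)) k                       ≡⟨ trans (coeff-·P a (p +P q) k) (cong (a ℤ.*_) (coeff-+P p q k)) ⟩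
    a ℤ.* (coeff p k ℤ.+ coeff q k)               ≡⟨ ℤ.*-distribˡ-+ a _ _ ⟩
    a ℤ.* coeff p k ℤ.+ a ℤ.* coeff q k           ≡⟨ trans (coeff-+P (a ·P p) (a ·P q) k) (cong₂ ℤ._+_ (coeff-·P a p k) (coeff-·P a q k)) ⟨
    coeff (a ·P p +P a ·P q) k                    ∎
    where open ≡-Reasoning

  ·P-assoc : ∀ a b p → a ·P (b ·P p) ≋ (a ℤ.* b) ·P p
  ·P-assoc a b p = mk≋ λ k →
    trans (coeff-·P a (b ·P p) k) (trans (cong (a ℤ.*_) (coeff-·P b p k))
      (trans (sym (ℤ.*-assoc a b _)) (sym (coeff-·P (a ℤ.* b) p k))))

  ·P-zeroˡ : ∀ p → + 0 ·P p ≋ []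
  ·P-zeroˡ p = mk≋ (coeff-·P (+ 0) p)

  ·P-identityˡ : ∀ p → + 1 ·P p ≋ p
  ·P-identityˡ p = mk≋ λ k → trans (coeff-·P (+ 1) p k) (ℤ.*-identityˡ _)

  x· : Poly → Poly
  x· p = + 0 ∷ p

  x·-[] : x· [] ≋ []
  x·-[] = mk≋ λ { zero → refl ; (suc k) → refl }

  x·-+P : ∀ p q → x· (p +P q) ≋ x· p +P x· q
  x·-+P p q = mk≋ λ { zero → refl ; (suc k) → refl }

  x·-·P : ∀ a p → x· (a ·P p) ≋ a ·P x· p
  x·-·P a p = mk≋ λ { zero → sym (ℤ.*-zeroʳ a) ; (suc k) → refl }

  x·-cong : ∀ {p q} → p ≋ q → x· p ≋ x· q
  x·-cong = ∷-cong refl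

  *P-zeroʳ : ∀ p → p *P [] ≋ []
  *P-zeroʳ []      = ≋-refl
  *P-zeroʳ (a ∷ p) = ≋-trans (x·-cong (*P-zeroʳ p)) x·-[]

  *P-congʳ : ∀ p {q q′} → q ≋ q′ → p *P q ≋ p *P q′
  *P-congʳ []      e = ≋-refl
  *P-congʳ (a ∷ p) e = +P-cong (·P-cong a e) (x·-cong (*P-congʳ p e))

  +P-interchange : ∀ p q r s → (p +P q) +P (r +P s) ≋ (p +P r) +P (q +P s)
  +P-interchange p q r s = mk≋ λ k → begin
    coeff ((p +P q) +P (r +P s)) k
      ≡⟨ trans (coeff-+P (p +P q) (r +P s) k) (cong₂ ℤ._+_ (coeff-+P p q k) (coeff-+P r s k)) ⟩
    (coeff p k ℤ.+ coeff q k) ℤ.+ (coeff r k ℤ.+ coeff s k)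
      ≡⟨ interchange (coeff p k) (coeff q k) (coeff r k) (coeff s k) ⟩
    (coeff p k ℤ.+ coeff r k) ℤ.+ (coeff q k ℤ.+ coeff s k)
      ≡⟨ trans (coeff-+P (p +P r) (q +P s) k) (cong₂ ℤ._+_ (coeff-+P p r k) (coeff-+P q s k)) ⟨
    coeff ((p +P r) +P (q +P s)) k ∎
    where
    open ≡-Reasoning
    interchange : ∀ w x y z → (w ℤ.+ x) ℤ.+ (y ℤ.+ z) ≡ (w ℤ.+ y) ℤ.+ (x ℤ.+ z)
    interchange = solve-∀

  *P-distribˡ : ∀ p q r → p *P (q +P r) ≋ p *P q +P p *P r
  *P-distribˡ []      q r = ≋-refl
  *P-distribˡ (a ∷ p) q r =
    ≋-trans (+P-cong (·P-distrib-+P a q r) (≋-trans (x·-cong (*P-distribˡ p q r)) (x·-+P (p *P q) (p *P r))))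
            (+P-interchange (a ·P q) (a ·P r) (x· (p *P q)) (x· (p *P r)))

  *P-∷ : ∀ p b q → p *P (b ∷ q) ≋ b ·P p +P x· (p *P q)
  *P-∷ []      b q = ≋-sym x·-[]
  *P-∷ (a ∷ p) b q = mk≋ λ
    { zero    → trans (ℤ.+-identityʳ _) (trans (ℤ.*-comm a b) (sym (ℤ.+-identityʳ _)))
    ; (suc k) → ≋⇒≈P (≋-trans (+P-cong (≋-refl {a ·P q}) (*P-∷ p b q)) (swap (a ·P q) (b ·P p) (x· (p *P q)))) k }
    where
    swap : ∀ r s t → r +P (s +P t) ≋ s +P (r +P t)
    swap r s t = ≋-trans (≋-sym (+P-assoc r s t)) (≋-trans (+P-cong (+P-comm r s) ≋-refl) (+P-assoc s r t))

  *P-comm : ∀ p q → p *P q ≋ q *P p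
  *P-comm []      q = ≋-sym (*P-zeroʳ q)
  *P-comm (a ∷ p) q = ≋-trans (+P-cong ≋-refl (x·-cong (*P-comm p q))) (≋-sym (*P-∷ q a p))

  *P-congˡ : ∀ {p p′} q → p ≋ p′ → p *P q ≋ p′ *P q
  *P-congˡ {p} {p′} q e = ≋-trans (*P-comm p q) (≋-trans (*P-congʳ q e) (*P-comm q p′))

  *P-cong : ∀ {p p′ q q′} → p ≋ p′ → q ≋ q′ → p *P q ≋ p′ *P q′
  *P-cong {p′ = p′} {q = q} e f = ≋-trans (*P-congˡ q e) (*P-congʳ p′ f)

  *P-distribʳ : ∀ p q r → (q +P r) *P p ≋ q *P p +P r *P p
  *P-distribʳ p q r = ≋-trans (*P-comm (q +P r) p)
    (≋-trans (*P-distribˡ p q r) (+P-cong (*P-comm p q) (*P-comm p r)))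

  ·P-*P : ∀ a p q → (a ·P p) *P q ≋ a ·P (p *P q)
  ·P-*P a []      q = ≋-refl
  ·P-*P a (x ∷ p) q =
    ≋-trans (+P-cong (≋-sym (·P-assoc a x q)) (≋-trans (x·-cong (·P-*P a p q)) (x·-·P a (p *P q))))
            (≋-sym (·P-distrib-+P a (x ·P q) (x· (p *P q))))

  x·-*P : ∀ p q → x· p *P q ≋ x· (p *P q)
  x·-*P p q = +P-cong (·P-zeroˡ q) ≋-refl

  *P-assoc : ∀ p q r → (p *P q) *P r ≋ p *P (q *P r)
  *P-assoc []      q r = ≋-refl
  *P-assoc (a ∷ p) q r =
    ≋-trans (*P-distribʳ r (a ·P q) (x· (p *P q)))
            (+P-cong (·P-*P a q r) (≋-trans (x·-*P (p *P q) r) (x·-cong (*P-assoc p q r))))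

  *P-identityˡ : ∀ p → constP (+ 1) *P p ≋ p
  *P-identityˡ p = ≋-trans (+P-cong (·P-identityˡ p) x·-[]) (+P-identityʳ p)

  *P-identityʳ : ∀ p → p *P constP (+ 1) ≋ p
  *P-identityʳ p = ≋-trans (*P-comm p _) (*P-identityˡ p)

  PolyRing : CommutativeRing 0ℓ 0ℓ
  PolyRing = record
    { Carrier = Poly ; _≈_ = _≋_ ; _+_ = _+P_ ; _*_ = _*P_ ; -_ = negP ; 0# = [] ; 1# = constP (+ 1)
    ; isCommutativeRing = record
      { isRing = record
        { +-isAbelianGroup = record
          { isGroup = record
            { isMonoid = record
              { isSemigroup = record
                { isMagma = record
                  { isEquivalence = record { refl = ≋-refl ; sym = ≋-sym ; trans = ≋-trans }
                  ; ∙-cong = +P-cong }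
                ; assoc = +P-assoc }
              ; identity = (λ _ → ≋-refl) , +P-identityʳ }
            ; inverse = negP-inverseˡ , (λ p → ≋-trans (+P-comm p (negP p)) (negP-inverseˡ p))
            ; ⁻¹-cong = ·P-cong (- + 1) }
          ; comm = +P-comm }
        ; *-cong = *P-cong
        ; *-assoc = *P-assoc
        ; *-identity = *P-identityˡ , *P-identityʳ
        ; distrib = *P-distribˡ , *P-distribʳ }
      ; *-comm = *P-comm } }

  open CommutativeRing PolyRing using (commutativeSemiring; rawRing)
  open import Algebra.Solver.Ring.NaturalCoefficients.Default commutativeSemiring

  ∷-≋-tail : ∀ {a b p q} → a ∷ p ≋ b ∷ q → p ≋ q
  ∷-≋-tail e = mk≋ λ k → ≋⇒≈P e (suc k)

  ∷-≋[]-tail : ∀ {a p} → a ∷ p ≋ [] → p ≋ []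
  ∷-≋[]-tail e = mk≋ λ k → ≋⇒≈P e (suc k)

  constP-*P : ∀ c p → constP c *P p ≋ c ·P p
  constP-*P c p = ≋-trans (+P-cong ≋-refl x·-[]) (+P-identityʳ _)

  ∘P-≋[] : ∀ {p} s → p ≋ [] → p ∘P s ≋ []
  ∘P-≋[] {[]}    s e = ≋-refl
  ∘P-≋[] {a ∷ p} s e = +P-cong (mk≋ λ { zero → ≋⇒≈P e zero ; (suc k) → refl })
                               (≋-trans (*P-congʳ s (∘P-≋[] s (∷-≋[]-tail e))) (*P-zeroʳ s))

  ∘P-congˡ : ∀ {p p′} s → p ≋ p′ → p ∘P s ≋ p′ ∘P s
  ∘P-congˡ {[]}              s e = ≋-sym (∘P-≋[] s (≋-sym e))
  ∘P-congˡ {a ∷ p} {[]}      s e = ∘P-≋[] s e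
  ∘P-congˡ {a ∷ p} {b ∷ p′}  s e =
    +P-cong (∷-cong (≋⇒≈P e zero) ≋-refl) (*P-congʳ s (∘P-congˡ s (∷-≋-tail e)))

  ∘P-constP : ∀ c s → constP c ∘P s ≋ constP c
  ∘P-constP c s = ≋-trans (+P-cong ≋-refl (*P-zeroʳ s)) (+P-identityʳ _)

  ∘P-X : ∀ s → X ∘P s ≋ s
  ∘P-X s = ≋-trans (+P-cong x·-[] (*P-congʳ s (∘P-constP (+ 1) s))) (*P-identityʳ s)

  ∘P-+P : ∀ p q s → (p +P q) ∘P s ≋ p ∘P s +P q ∘P s
  ∘P-+P []      q       s = ≋-refl
  ∘P-+P (a ∷ p) []      s = ≋-sym (+P-identityʳ _)
  ∘P-+P (a ∷ p) (b ∷ q) s =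
    ≋-trans (+P-cong ≋-refl (*P-congʳ s (∘P-+P p q s)))
      (solve 5 (λ A B S P Q → (A :+ B) :+ S :* (P :+ Q) := (A :+ S :* P) :+ (B :+ S :* Q))
             ≋-refl (constP a) (constP b) s (p ∘P s) (q ∘P s))

  ∘P-·P : ∀ c p s → (c ·P p) ∘P s ≋ constP c *P (p ∘P s)
  ∘P-·P c []      s = ≋-sym (*P-zeroʳ (constP c))
  ∘P-·P c (a ∷ p) s =
    ≋-trans (+P-cong (≋-sym (constP-*P c (constP a))) (*P-congʳ s (∘P-·P c p s)))
      (solve 4 (λ C A S P → C :* A :+ S :* (C :* P) := C :* (A :+ S :* P))
             ≋-refl (constP c) (constP a) s (p ∘P s))

  ∘P-*P : ∀ p q s → (p *P q) ∘P s ≋ (p ∘P s) *P (q ∘P s)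
  ∘P-*P []      q s = ≋-refl
  ∘P-*P (a ∷ p) q s = begin
    (a ·P q +P x· (p *P q)) ∘P s                              ≈⟨ ∘P-+P (a ·P q) (x· (p *P q)) s ⟩
    (a ·P q) ∘P s +P (constP (+ 0) +P s *P ((p *P q) ∘P s))   ≈⟨ +P-cong (∘P-·P a q s) (+P-cong x·-[] (*P-congʳ s (∘P-*P p q s))) ⟩
    constP a *P (q ∘P s) +P s *P ((p ∘P s) *P (q ∘P s))       ≈⟨ solve 4 (λ A S P Q → A :* Q :+ S :* (P :* Q) := (A :+ S :* P) :* Q)
                                                                        ≋-refl (constP a) s (p ∘P s) (q ∘P s) ⟩
    (constP a +P s *P (p ∘P s)) *P (q ∘P s)                   ∎
    where open import Relation.Binary.Reasoning.Setoid (CommutativeRing.setoid PolyRing)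

  ∘P-negP : ∀ p s → negP p ∘P s ≋ negP (p ∘P s)
  ∘P-negP p s = ≋-trans (∘P-·P (- + 1) p s) (constP-*P (- + 1) (p ∘P s))

  open RingMorphisms rawRing rawRing using (IsRingHomomorphism)

  ∘P-isRingHomomorphism : ∀ s → IsRingHomomorphism (_∘P s)
  ∘P-isRingHomomorphism s = record
    { isSemiringHomomorphism = record
      { isNearSemiringHomomorphism = record
        { +-isMonoidHomomorphism = record
          { isMagmaHomomorphism = record
            { isRelHomomorphism = record { cong = ∘P-congˡ s }
            ; homo = λ p q → ∘P-+P p q s }
          ; ε-homo = ≋-refl }
        ; *-homo = λ p q → ∘P-*P p q s }
      ; 1#-homo = ∘P-constP (+ 1) s }
    ; -‿homo = λ p → ∘P-negP p s }

open Polynomials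

module Indexing where
  open import Data.Nat as ℕ using (ℕ; zero; suc; _+_; _∸_; _<_; _≤_; z≤n; s≤s; _≡ᵇ_)
  import Data.Nat.Properties as ℕ
  open import Data.Fin using (Fin; zero; suc; toℕ; punchIn)
  open import Data.Fin.Properties using (suc-injective)
  open import Data.Product using (_×_; _,_)
  open import Data.Sum using (_⊎_; inj₁; inj₂)
  open import Data.Empty using (⊥-elim)
  open import Data.Bool using (Bool; true; false; not; T)
  open import Data.Bool.Properties using (T-≡)
  open import Data.Bool.ListAction using (any)
  open import Data.List using (List; []; _∷_; _++_; length; lookup; filterᵇ; upTo)
  open import Data.List.Properties using (length-++; upTo-∷ʳ; length-upTo)
  open import Data.List.Membership.Propositional using (lose)
  open import Data.List.Membership.Propositional.Properties using (∈-upTo⁺)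
  open import Data.List.Relation.Unary.Any.Properties using (any⁺)
  open import Data.List.Relation.Unary.All using (All; []; _∷_)
  open import Data.List.Relation.Unary.AllPairs using (AllPairs; []; _∷_)
  open import Function using (Equivalence; case_of_; _∘_)
  open import Relation.Nullary using (yes; no)
  open import Relation.Binary.PropositionalEquality
  open import Defs using (count)

  any-upTo : ∀ (p : ℕ → Bool) {n x} → x < n → p x ≡ true → any p (upTo n) ≡ true
  any-upTo p x<n px = Equivalence.to T-≡ (any⁺ p (lose (∈-upTo⁺ x<n) (Equivalence.from T-≡ px)))

  any-none : ∀ (p : ℕ → Bool) xs → (∀ x → p x ≡ false) → any p xs ≡ false
  any-none p []       _    = refl
  any-none p (x ∷ xs) none rewrite none x = any-none p xs none

  ≡ᵇ-refl : ∀ n → (n ≡ᵇ n) ≡ true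
  ≡ᵇ-refl zero    = refl
  ≡ᵇ-refl (suc n) = ≡ᵇ-refl n

  ≢⇒≡ᵇ-false : ∀ {m n} → m ≢ n → (m ≡ᵇ n) ≡ false
  ≢⇒≡ᵇ-false {zero}  {zero}  m≢n = ⊥-elim (m≢n refl)
  ≢⇒≡ᵇ-false {zero}  {suc n} _   = refl
  ≢⇒≡ᵇ-false {suc m} {zero}  _   = refl
  ≢⇒≡ᵇ-false {suc m} {suc n} m≢n = ≢⇒≡ᵇ-false (m≢n ∘ cong suc)

  ≡ᵇ-true⇒≡ : ∀ {m n} → (m ≡ᵇ n) ≡ true → m ≡ n
  ≡ᵇ-true⇒≡ {m} {n} eq = ℕ.≡ᵇ⇒≡ m n (subst T (sym eq) _)

  ≡ᵇ-false⇒≢ : ∀ {m n} → (m ≡ᵇ n) ≡ false → m ≢ n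
  ≡ᵇ-false⇒≢ {m} eq refl = case trans (sym eq) (≡ᵇ-refl m) of λ ()

  toℕ-punchIn : ∀ {n} (j : Fin (suc n)) (x : Fin n) →
                (toℕ x < toℕ j × toℕ (punchIn j x) ≡ toℕ x) ⊎ (toℕ j ≤ toℕ x × toℕ (punchIn j x) ≡ suc (toℕ x))
  toℕ-punchIn zero    x       = inj₂ (z≤n , refl)
  toℕ-punchIn (suc j) zero    = inj₁ (s≤s z≤n , refl)
  toℕ-punchIn (suc j) (suc x) with toℕ-punchIn j x
  ... | inj₁ (x<j , eq) = inj₁ (s≤s x<j , cong suc eq)
  ... | inj₂ (j≤x , eq) = inj₂ (s≤s j≤x , cong suc eq)

  punchIn-punchIn : ∀ {n} (q : Fin (suc (suc n))) (c q′ : Fin (suc n)) (x : Fin n) →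
                    punchIn (punchIn q c) q′ ≡ q → punchIn (punchIn q c) (punchIn q′ x) ≡ punchIn q (punchIn c x)
  punchIn-punchIn zero    c       zero     x       _  = refl
  punchIn-punchIn (suc q) zero    q′       x       refl = refl
  punchIn-punchIn (suc q) (suc c) (suc q′) zero    _  = refl
  punchIn-punchIn (suc q) (suc c) (suc q′) (suc x) eq = cong suc (punchIn-punchIn q c q′ x (suc-injective eq))

  punchIn-punchIn-parity : ∀ {n} (q : Fin (suc (suc n))) (c q′ : Fin (suc n)) → punchIn (punchIn q c) q′ ≡ q →
                           toℕ (punchIn q c) + toℕ q′ ≡ suc (toℕ q + toℕ c) ⊎
                           2 + (toℕ (punchIn q c) + toℕ q′) ≡ suc (toℕ q + toℕ c)
  punchIn-punchIn-parity zero    c       zero     _      = inj₁ (ℕ.+-identityʳ _)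
  punchIn-punchIn-parity (suc q) zero    q′       refl = inj₂ (cong suc (sym (ℕ.+-identityʳ _)))
  punchIn-punchIn-parity {suc n} (suc q) (suc c) (suc q′) eq with punchIn-punchIn-parity q c q′ (suc-injective eq)
  ... | inj₁ e = inj₁ (cong suc (trans (ℕ.+-suc _ (toℕ q′)) (trans (cong suc e) (cong suc (sym (ℕ.+-suc (toℕ q) _))))))
  ... | inj₂ e = inj₂ (cong suc (trans (cong (2 +_) (ℕ.+-suc _ (toℕ q′))) (trans (cong suc e) (cong suc (sym (ℕ.+-suc (toℕ q) _))))))

  nth : List ℕ → ℕ → ℕ
  nth []       _       = 0
  nth (x ∷ xs) zero    = x
  nth (x ∷ xs) (suc k) = nth xs k

  nth-middle : ∀ pre u ws → nth (pre ++ u ∷ ws) (length pre) ≡ u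
  nth-middle []        u ws = refl
  nth-middle (x ∷ pre) u ws = nth-middle pre u ws

  nth-beforeMiddle : ∀ pre u ws {k} → k < length pre → nth (pre ++ u ∷ ws) k ≡ nth (pre ++ ws) k
  nth-beforeMiddle (x ∷ pre) u ws {zero}  _         = refl
  nth-beforeMiddle (x ∷ pre) u ws {suc k} (s≤s k<l) = nth-beforeMiddle pre u ws k<l

  nth-afterMiddle : ∀ pre u ws {k} → length pre ≤ k → nth (pre ++ u ∷ ws) (suc k) ≡ nth (pre ++ ws) k
  nth-afterMiddle []        u ws _               = refl
  nth-afterMiddle (x ∷ pre) u ws {suc k} (s≤s l≤k) = nth-afterMiddle pre u ws l≤k

  length-middle : ∀ pre (u : ℕ) ws → length (pre ++ u ∷ ws) ≡ suc (length (pre ++ ws))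
  length-middle pre u ws = trans (length-++ pre) (trans (ℕ.+-suc (length pre) _) (cong suc (sym (length-++ pre))))

  lookup≡nth : ∀ xs (i : Fin (length xs)) → lookup xs i ≡ nth xs (toℕ i)
  lookup≡nth (x ∷ xs) zero    = refl
  lookup≡nth (x ∷ xs) (suc i) = lookup≡nth xs i

  All-nth : ∀ {p} {P : ℕ → Set p} {xs} → All P xs → ∀ {k} → k < length xs → P (nth xs k)
  All-nth (px ∷ _)   {zero}  _         = px
  All-nth (_ ∷ pxs) {suc k} (s≤s k<l) = All-nth pxs k<l

  All-removeMiddle : ∀ {p} {P : ℕ → Set p} pre {u} ws → All P (pre ++ u ∷ ws) → All P (pre ++ ws)
  All-removeMiddle []        ws (_ ∷ pws)  = pws
  All-removeMiddle (x ∷ pre) ws (px ∷ pws) = px ∷ All-removeMiddle pre ws pws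

  AllPairs-removeMiddle : ∀ {r} {R : ℕ → ℕ → Set r} pre {u} ws → AllPairs R (pre ++ u ∷ ws) → AllPairs R (pre ++ ws)
  AllPairs-removeMiddle []        ws (_ ∷ rws)  = rws
  AllPairs-removeMiddle (x ∷ pre) ws (rx ∷ rws) = All-removeMiddle pre ws rx ∷ AllPairs-removeMiddle pre ws rws

  nth-injective : ∀ {xs} → AllPairs _≢_ xs → ∀ {k l} → k < length xs → l < length xs → nth xs k ≡ nth xs l → k ≡ l
  nth-injective (_ ∷ _)    {zero}  {zero}  _         _         _  = refl
  nth-injective (x≢ ∷ _)   {zero}  {suc l} _         (s≤s l<) eq = ⊥-elim (All-nth x≢ l< eq)
  nth-injective (x≢ ∷ _)   {suc k} {zero}  (s≤s k<) _         eq = ⊥-elim (All-nth x≢ k< (sym eq))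
  nth-injective (_ ∷ dist) {suc k} {suc l} (s≤s k<) (s≤s l<) eq = cong suc (nth-injective dist k< l< eq)

  nth-≡ᵇ : ∀ {xs} → AllPairs _≢_ xs → ∀ {k l} → k < length xs → l < length xs → (nth xs k ≡ᵇ nth xs l) ≡ (k ≡ᵇ l)
  nth-≡ᵇ {xs} distinct {k} {l} k< l< with k ℕ.≟ l
  ... | yes refl = trans (≡ᵇ-refl (nth xs k)) (sym (≡ᵇ-refl k))
  ... | no k≢l   = trans (≢⇒≡ᵇ-false (k≢l ∘ nth-injective distinct k< l<)) (sym (≢⇒≡ᵇ-false k≢l))

  <⇒≡suc-∸-+ : ∀ {a b} → a < b → b ≡ suc (b ∸ suc a + a)
  <⇒≡suc-∸-+ {a} {b} a<b = trans (sym (ℕ.m∸n+n≡m a<b)) (ℕ.+-suc (b ∸ suc a) a)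

  Adjacent : ∀ {n} → Fin n → Fin n → Set
  Adjacent x y = toℕ y ≡ suc (toℕ x)

  Adjacent⇒≢ : ∀ {n} {x y : Fin n} → Adjacent x y → x ≢ y
  Adjacent⇒≢ adj x≡y = ℕ.1+n≢n (sym (trans (cong toℕ x≡y) adj))

  adjacent-punchIn⁻¹ : ∀ {n} (j : Fin (suc n)) {x y : Fin n} → Adjacent (punchIn j x) (punchIn j y) → Adjacent x y
  adjacent-punchIn⁻¹ j {x} {y} adj with toℕ-punchIn j x | toℕ-punchIn j y
  ... | inj₁ (_ , px) | inj₁ (_ , py) = trans (sym py) (trans adj (cong suc px))
  ... | inj₂ (_ , px) | inj₂ (_ , py) = ℕ.suc-injective (trans (sym py) (trans adj (cong suc px)))
  ... | inj₁ (x<j , px) | inj₂ (j≤y , py) =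
    ⊥-elim (ℕ.<-irrefl (sym (ℕ.suc-injective (trans (sym py) (trans adj (cong suc px))))) (ℕ.<-≤-trans x<j j≤y))
  ... | inj₂ (j≤x , px) | inj₁ (y<j , py) =
    ⊥-elim (ℕ.<-asym (ℕ.<-≤-trans y<j j≤x) (ℕ.≤-trans (ℕ.n≤1+n (suc (toℕ x))) (ℕ.≤-reflexive
      (sym (trans (sym py) (trans adj (cong suc px)))))))

  count-++ : ∀ (P : ℕ → Bool) xs ys → count P (xs ++ ys) ≡ count P xs + count P ys
  count-++ P []       ys = refl
  count-++ P (x ∷ xs) ys with P x
  ... | true  = cong suc (count-++ P xs ys)
  ... | false = count-++ P xs ys

  count-complement : ∀ (P : ℕ → Bool) xs → count P xs + count (not ∘ P) xs ≡ length xs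
  count-complement P []       = refl
  count-complement P (x ∷ xs) with P x
  ... | true  = cong suc (count-complement P xs)
  ... | false = trans (ℕ.+-suc _ _) (cong suc (count-complement P xs))

  count-cong : ∀ {P Q : ℕ → Bool} {xs} → All (λ x → P x ≡ Q x) xs → count P xs ≡ count Q xs
  count-cong {xs = []}     []       = refl
  count-cong {Q = Q} {xs = x ∷ xs} (Px≡Qx ∷ eqs) rewrite Px≡Qx with Q x
  ... | true  = cong suc (count-cong eqs)
  ... | false = count-cong eqs

  count-partition : ∀ (P Q : ℕ → Bool) xs → count P xs ≡ count P (filterᵇ Q xs) + count P (filterᵇ (not ∘ Q) xs)
  count-partition P Q []       = refl
  count-partition P Q (x ∷ xs) with Q x
  ... | true  with P x
  ...   | true  = cong suc (count-partition P Q xs)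
  ...   | false = count-partition P Q xs
  count-partition P Q (x ∷ xs) | false with P x
  ...   | true  = trans (cong suc (count-partition P Q xs)) (sym (ℕ.+-suc _ _))
  ...   | false = count-partition P Q xs

  count-filter : ∀ (P Q : ℕ → Bool) xs → All (λ x → Q x ≡ true → P x ≡ true) xs → count P (filterᵇ Q xs) ≡ count Q xs
  count-filter P Q []       []         = refl
  count-filter P Q (x ∷ xs) (Q⇒P ∷ hs) with Q x in Qx
  ... | true  rewrite Q⇒P refl = cong suc (count-filter P Q xs hs)
  ... | false = count-filter P Q xs hs

  filterᵇ-cong : ∀ {P Q : ℕ → Bool} {xs} → All (λ x → P x ≡ Q x) xs → filterᵇ P xs ≡ filterᵇ Q xs
  filterᵇ-cong {xs = []}     []       = refl
  filterᵇ-cong {Q = Q} {xs = x ∷ xs} (Px≡Qx ∷ eqs) rewrite Px≡Qx with Q x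
  ... | true  = cong (x ∷_) (filterᵇ-cong eqs)
  ... | false = filterᵇ-cong eqs

  count-upTo-suc : ∀ (P : ℕ → Bool) n → count P (upTo (suc n)) ≡ count P (upTo n) + count P (n ∷ [])
  count-upTo-suc P n = trans (cong (count P) (sym (upTo-∷ʳ n))) (count-++ P (upTo n) (n ∷ []))

  count-≡ᵇ-upTo-≥ : ∀ {u} n → n ≤ u → count (u ≡ᵇ_) (upTo n) ≡ 0
  count-≡ᵇ-upTo-≥         zero    _   = refl
  count-≡ᵇ-upTo-≥ {u} (suc n) n<u = begin
    count (u ≡ᵇ_) (upTo (suc n))                     ≡⟨ count-upTo-suc (u ≡ᵇ_) n ⟩
    count (u ≡ᵇ_) (upTo n) + count (u ≡ᵇ_) (n ∷ [])
      ≡⟨ cong₂ _+_ (count-≡ᵇ-upTo-≥ n (ℕ.<⇒≤ n<u)) (cong (λ b → count (λ _ → b) (n ∷ [])) (≢⇒≡ᵇ-false (ℕ.<⇒≢ n<u ∘ sym))) ⟩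
    0                                                ∎
    where open ≡-Reasoning

  count-≡ᵇ-upTo-< : ∀ {u} n → u < n → count (u ≡ᵇ_) (upTo n) ≡ 1
  count-≡ᵇ-upTo-< {u} (suc n) u<1+n with ℕ.m≤n⇒m<n∨m≡n (ℕ.≤-pred u<1+n)
  ... | inj₁ u<n  = trans (count-upTo-suc (u ≡ᵇ_) n) (cong₂ _+_ (count-≡ᵇ-upTo-< n u<n)
                      (cong (λ b → count (λ _ → b) (n ∷ [])) (≢⇒≡ᵇ-false (ℕ.<⇒≢ u<n))))
  ... | inj₂ refl = trans (count-upTo-suc (u ≡ᵇ_) u) (cong₂ _+_ (count-≡ᵇ-upTo-≥ u ℕ.≤-refl)
                      (cong (λ b → count (λ _ → b) (u ∷ [])) (≡ᵇ-refl u)))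

  count-≢-upTo : ∀ {u} m → u < suc m → count (not ∘ (u ≡ᵇ_)) (upTo (suc m)) ≡ m
  count-≢-upTo {u} m u<n = ℕ.+-cancelˡ-≡ 1 _ _ (begin
    1 + count (not ∘ (u ≡ᵇ_)) (upTo (suc m))
      ≡⟨ cong (_+ count (not ∘ (u ≡ᵇ_)) (upTo (suc m))) (count-≡ᵇ-upTo-< (suc m) u<n) ⟨
    count (u ≡ᵇ_) (upTo (suc m)) + count (not ∘ (u ≡ᵇ_)) (upTo (suc m))
      ≡⟨ count-complement (u ≡ᵇ_) (upTo (suc m)) ⟩
    length (upTo (suc m))
      ≡⟨ length-upTo (suc m) ⟩
    suc m ∎)
    where open ≡-Reasoning

open Indexing

module Determinant {c ℓ} (R : CommutativeRing c ℓ) where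
  open import Algebra.Bundles using (RawRing)
  open import Data.Nat as ℕ using (ℕ; zero; suc; z≤n; s≤s)
  import Data.Nat.Properties as ℕ
  open import Data.Fin as Fin using (Fin; zero; suc; toℕ; punchIn; punchOut; inject₁; fromℕ<)
  open import Data.Fin.Properties using (_≟_; punchInᵢ≢i; punchIn-injective; punchIn-punchOut; toℕ-injective; toℕ-inject₁; suc-injective; toℕ<n; toℕ-fromℕ<)
  open import Data.Product using (_×_; _,_)
  open import Data.Sum as Sum using (_⊎_; inj₁; inj₂)
  open import Data.Nat.Tactic.RingSolver using (solve-∀)
  open import Data.Empty using (⊥-elim)
  open import Function using (_∘_)
  open import Data.Vec.Functional using (updateAt)
  open import Data.Vec.Functional.Properties using (updateAt-updates; updateAt-minimal)
  open import Relation.Binary.Definitions using (tri<; tri≈; tri>)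
  open import Relation.Nullary using (yes; no; Dec)
  open import Relation.Binary.PropositionalEquality as ≡ using (_≡_; _≢_)
  open import Algebra.Morphism.Structures using (module RingMorphisms)
  open import Data.List using (List; []; _∷_; _++_; length; filterᵇ)
  open import Data.List.Properties using (length-++; ++-assoc)
  open import Data.List.Relation.Unary.All using (All; []; _∷_)
  open import Data.List.Relation.Unary.AllPairs using (AllPairs; []; _∷_)
  open import Data.Bool using (Bool; true; false; not)
  open import Defs using (count)

  open CommutativeRing R hiding (zero)
  open import Algebra.Properties.Ring ring using (-0#≈0#; -‿involutive; -‿+-comm; -‿distribʳ-*; +-inverseʳ-unique; x+x≈x⇒x≈0)
  open import Algebra.Properties.Semiring.Sum semiring using (sum; sum-cong-≋; ∑-distrib-+; sum-remove; *-distribˡ-sum; sum-replicate-zero)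
  open import Algebra.Solver.Ring.NaturalCoefficients.Default commutativeSemiring
  open import Algebra.Definitions.RawSemiring (RawRing.rawSemiring rawRing) using (_^_)
  open import Relation.Binary.Reasoning.Setoid setoid

  signed : ℕ → Carrier → Carrier
  signed zero    x = x
  signed (suc k) x = - signed k x

  signed-cong : ∀ k {x y} → x ≈ y → signed k x ≈ signed k y
  signed-cong zero    e = e
  signed-cong (suc k) e = -‿cong (signed-cong k e)

  signed-≡ : ∀ {k l} → k ≡ l → ∀ x → signed k x ≈ signed l x
  signed-≡ ≡.refl x = refl

  signed-0# : ∀ k → signed k 0# ≈ 0#
  signed-0# zero    = refl
  signed-0# (suc k) = trans (-‿cong (signed-0# k)) -0#≈0#

  signed-+ : ∀ k x y → signed k (x + y) ≈ signed k x + signed k y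
  signed-+ zero    x y = refl
  signed-+ (suc k) x y = trans (-‿cong (signed-+ k x y)) (sym (-‿+-comm _ _))

  signed-* : ∀ k a x → signed k (a * x) ≈ a * signed k x
  signed-* zero    a x = refl
  signed-* (suc k) a x = trans (-‿cong (signed-* k a x)) (-‿distribʳ-* a _)

  signed-linear : ∀ k a x y → signed k (a * x + y) ≈ a * signed k x + signed k y
  signed-linear k a x y = trans (signed-+ k (a * x) y) (+-congʳ (signed-* k a x))

  signed-signed : ∀ k l x → signed k (signed l x) ≈ signed (k ℕ.+ l) x
  signed-signed zero    l x = refl
  signed-signed (suc k) l x = -‿cong (signed-signed k l x)

  signed-2+ : ∀ k x → signed (2 ℕ.+ k) x ≈ signed k x
  signed-2+ k x = -‿involutive (signed k x)

  signed-double : ∀ k x → signed (k ℕ.+ k) x ≈ x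
  signed-double zero    x = refl
  signed-double (suc k) x =
    trans (signed-≡ (≡.cong suc (ℕ.+-suc k k)) x) (trans (signed-2+ (k ℕ.+ k) x) (signed-double k x))

  signed-cancel : ∀ k x → signed k x + signed (suc k) x ≈ 0#
  signed-cancel k x = -‿inverseʳ (signed k x)

  sum-signed : ∀ {n} k (f : Fin n → Carrier) → sum (λ i → signed k (f i)) ≈ signed k (sum f)
  sum-signed {zero}  k f = sym (signed-0# k)
  sum-signed {suc n} k f = trans (+-congˡ (sum-signed k (λ i → f (suc i)))) (sym (signed-+ k _ _))

  sum-zero : ∀ {n} (f : Fin n → Carrier) → (∀ i → f i ≈ 0#) → sum f ≈ 0#
  sum-zero {n} f e = trans (sum-cong-≋ e) (sum-replicate-zero n)

  sum-single : ∀ {n} (f : Fin (suc n) → Carrier) p → (∀ i → f (punchIn p i) ≈ 0#) → sum f ≈ f p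
  sum-single f p e = trans (sum-remove {i = p} f) (trans (+-congˡ (sum-zero _ e)) (+-identityʳ _))

  sum-pair : ∀ {n} (f : Fin (suc n) → Carrier) {p q} (p≢q : p ≢ q) →
             (∀ j → j ≢ p → j ≢ q → f j ≈ 0#) → sum f ≈ f p + f q
  sum-pair {zero}  f {zero} {zero} p≢q e = ⊥-elim (p≢q ≡.refl)
  sum-pair {suc n} f {p}    {q}    p≢q e = begin
    sum f                                      ≈⟨ sum-remove {i = p} f ⟩
    f p + sum (λ i → f (punchIn p i))          ≈⟨ +-congˡ (sum-single (λ i → f (punchIn p i)) (punchOut p≢q) others) ⟩
    f p + f (punchIn p (punchOut p≢q))         ≡⟨ ≡.cong (λ j → f p + f j) (punchIn-punchOut p≢q) ⟩
    f p + f q                                  ∎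
    where
    others : ∀ i → f (punchIn p (punchIn (punchOut p≢q) i)) ≈ 0#
    others i = e _ (punchInᵢ≢i p _) λ eq →
      punchInᵢ≢i (punchOut p≢q) i (punchIn-injective p _ _ (≡.trans eq (≡.sym (punchIn-punchOut p≢q))))

  Matrix : ℕ → Set c
  Matrix m = Fin m → Fin m → Carrier

  infix 4 _≈ₘ_
  _≈ₘ_ : ∀ {m} → Matrix m → Matrix m → Set ℓ
  M ≈ₘ N = ∀ r x → M r x ≈ N r x

  column : ∀ {m} → Matrix m → Fin m → Fin m → Carrier
  column M x r = M r x

  AgreeOff : ∀ {m} → Fin m → Matrix m → Matrix m → Set ℓ
  AgreeOff d M N = ∀ r x → x ≢ d → M r x ≈ N r x

  minor : ∀ {m} → Fin (suc m) → Matrix (suc m) → Matrix m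
  minor j M r x = M (suc r) (punchIn j x)

  det : ∀ {m} → Matrix m → Carrier
  det {zero}  M = 1#
  det {suc m} M = sum λ j → signed (toℕ j) (M zero j * det (minor j M))

  expansionTerm : ∀ {m} → Matrix (suc m) → Fin (suc m) → Carrier
  expansionTerm M j = signed (toℕ j) (M zero j * det (minor j M))

  det-cong : ∀ {m} {M N : Matrix m} → M ≈ₘ N → det M ≈ det N
  det-cong {zero}  e = refl
  det-cong {suc m} e = sum-cong-≋ λ j →
    signed-cong (toℕ j) (*-cong (e zero j) (det-cong λ r x → e (suc r) (punchIn j x)))

  minor-agreeOff-self : ∀ {m} {d : Fin (suc m)} {M N} → AgreeOff d M N → minor d M ≈ₘ minor d N
  minor-agreeOff-self {d = d} e r x = e (suc r) (punchIn d x) (punchInᵢ≢i d x)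

  minor-agreeOff : ∀ {m} {d j : Fin (suc m)} {M N} (j≢d : j ≢ d) → AgreeOff d M N →
                   AgreeOff (punchOut j≢d) (minor j M) (minor j N)
  minor-agreeOff {j = j} j≢d e r x x≢d′ = e (suc r) (punchIn j x) λ eq →
    x≢d′ (punchIn-injective j x _ (≡.trans eq (≡.sym (punchIn-punchOut j≢d))))

  minor-punchOut : ∀ {m} {d j : Fin (suc m)} (M : Matrix (suc m)) (j≢d : j ≢ d) r →
                   minor j M r (punchOut j≢d) ≡ M (suc r) d
  minor-punchOut M j≢d r = ≡.cong (M (suc r)) (punchIn-punchOut j≢d)

  det-linear : ∀ {m} (d : Fin m) a {M N K : Matrix m} → AgreeOff d M N → AgreeOff d M K →
               (∀ r → M r d ≈ a * N r d + K r d) → det M ≈ a * det N + det K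
  det-linear {suc m} d a {M} {N} {K} eN eK ed = begin
    det M                                                 ≈⟨ sum-cong-≋ termwise ⟩
    sum (λ j → a * expansionTerm N j + expansionTerm K j) ≈⟨ ∑-distrib-+ (λ j → a * expansionTerm N j) (expansionTerm K) ⟩
    sum (λ j → a * expansionTerm N j) + det K             ≈⟨ +-congʳ (*-distribˡ-sum a (expansionTerm N)) ⟨
    a * det N + det K                                     ∎
    where
    termwise : ∀ j → expansionTerm M j ≈ a * expansionTerm N j + expansionTerm K j
    termwise j with j ≟ d
    ... | yes ≡.refl = begin
      signed (toℕ j) (M zero j * det (minor j M))
        ≈⟨ signed-cong (toℕ j) (*-cong (ed zero) (det-cong (minor-agreeOff-self eN))) ⟩
      signed (toℕ j) ((a * N zero j + K zero j) * det (minor j N))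
        ≈⟨ signed-cong (toℕ j) (solve 4 (λ a n k D → (a :* n :+ k) :* D := a :* (n :* D) :+ k :* D) refl a _ _ _) ⟩
      signed (toℕ j) (a * (N zero j * det (minor j N)) + K zero j * det (minor j N))
        ≈⟨ signed-linear (toℕ j) a _ _ ⟩
      a * expansionTerm N j + signed (toℕ j) (K zero j * det (minor j N))
        ≈⟨ +-congˡ (signed-cong (toℕ j) (*-congˡ (det-cong λ r x →
             trans (sym (minor-agreeOff-self eN r x)) (minor-agreeOff-self eK r x)))) ⟩
      a * expansionTerm N j + expansionTerm K j ∎
    ... | no j≢d = begin
      signed (toℕ j) (M zero j * det (minor j M))
        ≈⟨ signed-cong (toℕ j) (*-congˡ (det-linear (punchOut j≢d) a
             (minor-agreeOff j≢d eN) (minor-agreeOff j≢d eK) columnₗ)) ⟩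
      signed (toℕ j) (M zero j * (a * det (minor j N) + det (minor j K)))
        ≈⟨ signed-cong (toℕ j) (solve 4 (λ x a n k → x :* (a :* n :+ k) := a :* (x :* n) :+ x :* k) refl _ a _ _) ⟩
      signed (toℕ j) (a * (M zero j * det (minor j N)) + M zero j * det (minor j K))
        ≈⟨ signed-linear (toℕ j) a _ _ ⟩
      a * signed (toℕ j) (M zero j * det (minor j N)) + signed (toℕ j) (M zero j * det (minor j K))
        ≈⟨ +-cong (*-congˡ (signed-cong (toℕ j) (*-congʳ (eN zero j j≢d))))
                  (signed-cong (toℕ j) (*-congʳ (eK zero j j≢d))) ⟩
      a * expansionTerm N j + expansionTerm K j ∎
      where
      columnₗ : ∀ r → minor j M r (punchOut j≢d) ≈ a * minor j N r (punchOut j≢d) + minor j K r (punchOut j≢d)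
      columnₗ r rewrite minor-punchOut M j≢d r | minor-punchOut N j≢d r | minor-punchOut K j≢d r = ed (suc r)

  entry-cong : ∀ {m} (M : Matrix m) r {x y : Fin m} → toℕ x ≡ toℕ y → M r x ≡ M r y
  entry-cong M r eq = ≡.cong (M r) (toℕ-injective eq)

  punchIn-adjacentEqualColumns : ∀ {m} (M : Matrix (suc m)) {x y} → Adjacent x y → (∀ r → M r x ≈ M r y) →
                                 ∀ r i → M r (punchIn x i) ≈ M r (punchIn y i)
  punchIn-adjacentEqualColumns M {x} {y} adj e r i with toℕ-punchIn x i | toℕ-punchIn y i
  ... | inj₁ (_ , px) | inj₁ (_ , py) = reflexive (entry-cong M r (≡.trans px (≡.sym py)))
  ... | inj₂ (_ , px) | inj₂ (_ , py) = reflexive (entry-cong M r (≡.trans px (≡.sym py)))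
  ... | inj₁ (i<x , _) | inj₂ (y≤i , _) =
    ⊥-elim (ℕ.<-asym i<x (ℕ.≤-trans (ℕ.≤-reflexive (≡.sym adj)) y≤i))
  ... | inj₂ (x≤i , px) | inj₁ (i<y , py) = begin
    M r (punchIn x i)  ≡⟨ entry-cong M r (≡.trans px (≡.trans (≡.cong suc i≡x) (≡.sym adj))) ⟩
    M r y              ≈⟨ e r ⟨
    M r x              ≡⟨ entry-cong M r (≡.trans (≡.sym i≡x) (≡.sym py)) ⟩
    M r (punchIn y i)  ∎
    where
    i≡x : toℕ i ≡ toℕ x
    i≡x = ℕ.≤-antisym (ℕ.≤-pred (ℕ.≤-trans i<y (ℕ.≤-reflexive adj))) x≤i

  det-adjacentEqualColumns : ∀ {m} (M : Matrix m) {x y} → Adjacent x y → (∀ r → M r x ≈ M r y) → det M ≈ 0#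
  det-adjacentEqualColumns {suc m} M {x} {y} adj e = begin
    det M                      ≈⟨ sum-pair (expansionTerm M) (Adjacent⇒≢ adj) otherTerms ⟩
    expansionTerm M x + expansionTerm M y            ≡⟨ ≡.cong (λ k → expansionTerm M x + signed k (M zero y * det (minor y M))) adj ⟩
    expansionTerm M x + signed (suc (toℕ x)) (M zero y * det (minor y M))
      ≈⟨ +-congˡ (signed-cong (suc (toℕ x)) (*-cong (sym (e zero))
           (det-cong λ r → sym ∘ punchIn-adjacentEqualColumns M adj e (suc r)))) ⟩
    expansionTerm M x + signed (suc (toℕ x)) (M zero x * det (minor x M))
      ≈⟨ signed-cancel (toℕ x) _ ⟩
    0#                         ∎
    where
    otherTerms : ∀ j → j ≢ x → j ≢ y → expansionTerm M j ≈ 0#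
    otherTerms j j≢x j≢y = trans (signed-cong (toℕ j) (trans (*-congˡ minor≈0) (zeroʳ _))) (signed-0# (toℕ j))
      where
      adj′ : Adjacent (punchOut j≢x) (punchOut j≢y)
      adj′ = adjacent-punchIn⁻¹ j (≡.subst₂ Adjacent (≡.sym (punchIn-punchOut j≢x)) (≡.sym (punchIn-punchOut j≢y)) adj)
      minor≈0 : det (minor j M) ≈ 0#
      minor≈0 = det-adjacentEqualColumns (minor j M) adj′ λ r →
        trans (reflexive (minor-punchOut M j≢x r)) (trans (e (suc r)) (reflexive (≡.sym (minor-punchOut M j≢y r))))

  withColumn : ∀ {m} → Matrix m → Fin m → (Fin m → Carrier) → Matrix m
  withColumn M d v r = updateAt (M r) d λ _ → v r

  withColumn-at : ∀ {m} (M : Matrix m) d v r → withColumn M d v r d ≡ v r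
  withColumn-at M d v r = updateAt-updates d (M r)

  withColumn-off : ∀ {m} (M : Matrix m) {d} v r {x} → x ≢ d → withColumn M d v r x ≡ M r x
  withColumn-off M {d} v r {x} x≢d = updateAt-minimal x d (M r) x≢d

  withColumn-agreeOff : ∀ {m} (M : Matrix m) d v → AgreeOff d (withColumn M d v) M
  withColumn-agreeOff M d v r x x≢d = reflexive (withColumn-off M v r x≢d)

  withColumn-withColumn : ∀ {m} (M : Matrix m) d u v → withColumn (withColumn M d u) d v ≈ₘ withColumn M d v
  withColumn-withColumn M d u v r x with x ≟ d
  ... | yes ≡.refl = reflexive (≡.trans (withColumn-at (withColumn M x u) x v r) (≡.sym (withColumn-at M x v r)))
  ... | no x≢d     = reflexive (≡.trans (withColumn-off (withColumn M d u) v r x≢d)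
                       (≡.trans (withColumn-off M u r x≢d) (≡.sym (withColumn-off M v r x≢d))))

  det-additive : ∀ {m} (d : Fin m) {M N K : Matrix m} → AgreeOff d M N → AgreeOff d M K →
                 (∀ r → M r d ≈ N r d + K r d) → det M ≈ det N + det K
  det-additive d eN eK ed = trans (det-linear d 1# eN eK λ r → trans (ed r) (+-congʳ (sym (*-identityˡ _))))
                                  (+-congʳ (*-identityˡ _))

  alternating⇒antisymmetric : ∀ {a} {A : Set a} (D : A → A → Carrier) (_⊕_ : A → A → A) →
                              (∀ u v w → D (u ⊕ v) w ≈ D u w + D v w) → (∀ u v w → D u (v ⊕ w) ≈ D u v + D u w) →
                              (∀ u → D u u ≈ 0#) → ∀ u v → D u v + D v u ≈ 0#
  alternating⇒antisymmetric D _⊕_ additiveˡ additiveʳ alternating u v = begin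
    D u v + D v u                              ≈⟨ solve 4 (λ uu uv vu vv → uv :+ vu := (con 0 :+ uv) :+ (vu :+ con 0)) refl (D u u) (D u v) (D v u) (D v v) ⟩
    (0# + D u v) + (D v u + 0#)                ≈⟨ +-cong (+-congʳ (alternating u)) (+-congˡ (alternating v)) ⟨
    (D u u + D u v) + (D v u + D v v)          ≈⟨ +-cong (additiveʳ u u v) (additiveʳ v u v) ⟨
    D u (u ⊕ v) + D v (u ⊕ v)                  ≈⟨ additiveˡ u v (u ⊕ v) ⟨
    D (u ⊕ v) (u ⊕ v)                          ≈⟨ alternating (u ⊕ v) ⟩
    0#                                         ∎

  withTwoColumns : ∀ {m} → Fin m → Fin m → (Fin m → Carrier) → (Fin m → Carrier) → Matrix m → Matrix m
  withTwoColumns x y u v M = withColumn (withColumn M y v) x u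

  withTwoColumns-atˡ : ∀ {m} (M : Matrix m) x y u v r → withTwoColumns x y u v M r x ≡ u r
  withTwoColumns-atˡ M x y u v r = withColumn-at (withColumn M y v) x u r

  withTwoColumns-atʳ : ∀ {m} (M : Matrix m) {x y} u v r → y ≢ x → withTwoColumns x y u v M r y ≡ v r
  withTwoColumns-atʳ M {x} {y} u v r y≢x = ≡.trans (withColumn-off (withColumn M y v) u r y≢x) (withColumn-at M y v r)

  withTwoColumns-off : ∀ {m} (M : Matrix m) {x y} u v r {z} → z ≢ x → z ≢ y → withTwoColumns x y u v M r z ≡ M r z
  withTwoColumns-off M {x} {y} u v r z≢x z≢y = ≡.trans (withColumn-off (withColumn M y v) u r z≢x) (withColumn-off M v r z≢y)

  swapColumns : ∀ {m} → Fin m → Fin m → Matrix m → Matrix m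
  swapColumns x y M = withTwoColumns x y (column M y) (column M x) M

  det-swapAdjacentColumns : ∀ {m} (M : Matrix m) {x y} → Adjacent x y → det (swapColumns x y M) ≈ - det M
  det-swapAdjacentColumns {m} M {x} {y} adj = +-inverseʳ-unique (det M) _ (begin
    det M + det (swapColumns x y M)                            ≈⟨ +-congʳ (det-cong unswapped) ⟨
    D (column M x) (column M y) + D (column M y) (column M x)  ≈⟨ alternating⇒antisymmetric D _⊕_ additiveˡ additiveʳ alternating _ _ ⟩
    0#                                                         ∎)
    where
    y≢x : y ≢ x
    y≢x = Adjacent⇒≢ adj ∘ ≡.sym
    D : (Fin m → Carrier) → (Fin m → Carrier) → Carrier
    D u v = det (withTwoColumns x y u v M)
    _⊕_ : (Fin m → Carrier) → (Fin m → Carrier) → Fin m → Carrier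
    (u ⊕ v) r = u r + v r
    agreeOff-x : ∀ u u′ v → AgreeOff x (withTwoColumns x y u v M) (withTwoColumns x y u′ v M)
    agreeOff-x u u′ v r z z≢x = reflexive (≡.trans (withColumn-off (withColumn M y v) u r z≢x)
                                                   (≡.sym (withColumn-off (withColumn M y v) u′ r z≢x)))
    agreeOff-y : ∀ u v v′ → AgreeOff y (withTwoColumns x y u v M) (withTwoColumns x y u v′ M)
    agreeOff-y u v v′ r z z≢y with z ≟ x
    ... | yes ≡.refl = reflexive (≡.trans (withTwoColumns-atˡ M z y u v r) (≡.sym (withTwoColumns-atˡ M z y u v′ r)))
    ... | no z≢x     = reflexive (≡.trans (withTwoColumns-off M u v r z≢x z≢y) (≡.sym (withTwoColumns-off M u v′ r z≢x z≢y)))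
    additiveˡ : ∀ u v w → D (u ⊕ v) w ≈ D u w + D v w
    additiveˡ u v w = det-additive x (agreeOff-x (u ⊕ v) u w) (agreeOff-x (u ⊕ v) v w) λ r → reflexive
      (≡.trans (withTwoColumns-atˡ M x y (u ⊕ v) w r) (≡.sym (≡.cong₂ _+_ (withTwoColumns-atˡ M x y u w r) (withTwoColumns-atˡ M x y v w r))))
    additiveʳ : ∀ u v w → D u (v ⊕ w) ≈ D u v + D u w
    additiveʳ u v w = det-additive y (agreeOff-y u (v ⊕ w) v) (agreeOff-y u (v ⊕ w) w) λ r → reflexive
      (≡.trans (withTwoColumns-atʳ M u (v ⊕ w) r y≢x) (≡.sym (≡.cong₂ _+_ (withTwoColumns-atʳ M u v r y≢x) (withTwoColumns-atʳ M u w r y≢x))))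
    alternating : ∀ u → D u u ≈ 0#
    alternating u = det-adjacentEqualColumns (withTwoColumns x y u u M) adj λ r →
      reflexive (≡.trans (withTwoColumns-atˡ M x y u u r) (≡.sym (withTwoColumns-atʳ M u u r y≢x)))
    unswapped : withTwoColumns x y (column M x) (column M y) M ≈ₘ M
    unswapped r z with z ≟ x | z ≟ y
    ... | yes ≡.refl | _          = reflexive (withTwoColumns-atˡ M z y (column M z) (column M y) r)
    ... | no z≢x     | yes ≡.refl = reflexive (withTwoColumns-atʳ M (column M x) (column M z) r z≢x)
    ... | no z≢x     | no z≢y     = reflexive (withTwoColumns-off M (column M x) (column M y) r z≢x z≢y)

  -≈0⇒≈0 : ∀ {x} → - x ≈ 0# → x ≈ 0#
  -≈0⇒≈0 {x} e = trans (sym (-‿involutive x)) (trans (-‿cong e) -0#≈0#)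

  det-equalColumnsAtDistance : ∀ t {m} (M : Matrix m) {x y} → toℕ y ≡ suc (t ℕ.+ toℕ x) →
                               (∀ r → M r x ≈ M r y) → det M ≈ 0#
  det-equalColumnsAtDistance zero    M adj e = det-adjacentEqualColumns M adj e
  det-equalColumnsAtDistance (suc t) M {x} {suc y} dist e = -≈0⇒≈0 (begin
    - det M                                  ≈⟨ det-swapAdjacentColumns M adj ⟨
    det (swapColumns (inject₁ y) (suc y) M)  ≈⟨ det-equalColumnsAtDistance t _ dist′ e′ ⟩
    0#                                       ∎)
    where
    adj : Adjacent (inject₁ y) (suc y)
    adj = ≡.cong suc (≡.sym (toℕ-inject₁ y))
    dist′ : toℕ (inject₁ y) ≡ suc (t ℕ.+ toℕ x)
    dist′ = ≡.trans (toℕ-inject₁ y) (ℕ.suc-injective dist)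
    x<y′ : toℕ x ℕ.< toℕ (inject₁ y)
    x<y′ = ℕ.≤-trans (s≤s (ℕ.m≤n+m (toℕ x) t)) (ℕ.≤-reflexive (≡.sym dist′))
    x≢y′ : x ≢ inject₁ y
    x≢y′ eq = ℕ.<-irrefl (≡.cong toℕ eq) x<y′
    x≢y : x ≢ suc y
    x≢y eq = ℕ.<-irrefl (≡.cong toℕ eq) (ℕ.<-trans x<y′ (ℕ.≤-reflexive (≡.sym adj)))
    e′ : ∀ r → swapColumns (inject₁ y) (suc y) M r x ≈ swapColumns (inject₁ y) (suc y) M r (inject₁ y)
    e′ r = trans (reflexive (withTwoColumns-off M (column M (suc y)) (column M (inject₁ y)) r x≢y′ x≢y))
                 (trans (e r) (reflexive (≡.sym (withTwoColumns-atˡ M (inject₁ y) (suc y) (column M (suc y)) (column M (inject₁ y)) r))))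

  det-equalColumns : ∀ {m} (M : Matrix m) {x y} → x ≢ y → (∀ r → M r x ≈ M r y) → det M ≈ 0#
  det-equalColumns M {x} {y} x≢y e with ℕ.<-cmp (toℕ x) (toℕ y)
  ... | tri< x<y _ _ = det-equalColumnsAtDistance _ M (<⇒≡suc-∸-+ x<y) e
  ... | tri≈ _ x≡y _ = ⊥-elim (x≢y (toℕ-injective x≡y))
  ... | tri> _ _ y<x = det-equalColumnsAtDistance _ M (<⇒≡suc-∸-+ y<x) (sym ∘ e)

  withColumn-cong : ∀ {m} (M : Matrix m) d {v w} → (∀ r → v r ≈ w r) → withColumn M d v ≈ₘ withColumn M d w
  withColumn-cong M d {v} {w} e r x with x ≟ d
  ... | yes ≡.refl = trans (reflexive (withColumn-at M x v r)) (trans (e r) (reflexive (≡.sym (withColumn-at M x w r))))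
  ... | no x≢d     = reflexive (≡.trans (withColumn-off M v r x≢d) (≡.sym (withColumn-off M w r x≢d)))

  withColumn-self : ∀ {m} (M : Matrix m) d {v} → (∀ r → v r ≈ M r d) → withColumn M d v ≈ₘ M
  withColumn-self M d {v} e r x with x ≟ d
  ... | yes ≡.refl = trans (reflexive (withColumn-at M x v r)) (e r)
  ... | no x≢d     = reflexive (withColumn-off M v r x≢d)

  withColumn-agreeOff₂ : ∀ {m} (M : Matrix m) d v w → AgreeOff d (withColumn M d v) (withColumn M d w)
  withColumn-agreeOff₂ M d v w r x x≢d = trans (withColumn-agreeOff M d v r x x≢d) (sym (withColumn-agreeOff M d w r x x≢d))

  det-zeroColumn : ∀ {m} (M : Matrix m) d → (∀ r → M r d ≈ 0#) → det M ≈ 0#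
  det-zeroColumn M d e = x+x≈x⇒x≈0 (det M) (sym (det-additive d (λ _ _ _ → refl) (λ _ _ _ → refl) λ r →
    trans (e r) (sym (trans (+-cong (e r) (e r)) (+-identityˡ 0#)))))

  det-scaleColumn : ∀ {m} (M : Matrix m) d a v → det (withColumn M d (λ r → a * v r)) ≈ a * det (withColumn M d v)
  det-scaleColumn M d a v = begin
    det (withColumn M d av)                                  ≈⟨ det-linear d a (withColumn-agreeOff₂ M d av v) (withColumn-agreeOff₂ M d av zeros) scaled ⟩
    a * det (withColumn M d v) + det (withColumn M d zeros)  ≈⟨ +-congˡ (det-zeroColumn (withColumn M d zeros) d λ r → reflexive (withColumn-at M d zeros r)) ⟩
    a * det (withColumn M d v) + 0#                          ≈⟨ +-identityʳ _ ⟩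
    a * det (withColumn M d v)                               ∎
    where
    av zeros : Fin _ → Carrier
    av r = a * v r
    zeros _ = 0#
    scaled : ∀ r → withColumn M d av r d ≈ a * withColumn M d v r d + withColumn M d zeros r d
    scaled r = trans (reflexive (withColumn-at M d av r)) (sym (trans (reflexive (≡.cong₂ (λ p q → a * p + q)
      (withColumn-at M d v r) (withColumn-at M d zeros r))) (+-identityʳ _)))

  det-addColumnMultiple : ∀ {m} (M : Matrix m) {d e} a → d ≢ e → det (withColumn M d (λ r → a * M r e + M r d)) ≈ det M
  det-addColumnMultiple M {d} {e} a d≢e = begin
    det (withColumn M d added)                    ≈⟨ det-linear d a (withColumn-agreeOff₂ M d added (column M e)) (withColumn-agreeOff M d added) combined ⟩
    a * det (withColumn M d (column M e)) + det M ≈⟨ +-congʳ (*-congˡ (det-equalColumns _ d≢e λ r → reflexive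
                                                       (≡.trans (withColumn-at M d (column M e) r) (≡.sym (withColumn-off M (column M e) r (d≢e ∘ ≡.sym)))))) ⟩
    a * 0# + det M                                ≈⟨ +-congʳ (zeroʳ a) ⟩
    0# + det M                                    ≈⟨ +-identityˡ _ ⟩
    det M                                         ∎
    where
    added : Fin _ → Carrier
    added r = a * M r e + M r d
    combined : ∀ r → withColumn M d added r d ≈ a * withColumn M d (column M e) r d + M r d
    combined r = reflexive (≡.trans (withColumn-at M d added r) (≡.cong (λ p → a * p + M r d) (≡.sym (withColumn-at M d (column M e) r))))

  det-row0 : ∀ {m} (M : Matrix (suc m)) → (∀ j → j ≢ zero → M zero j ≈ 0#) → det M ≈ M zero zero * det (minor zero M)
  det-row0 M e = sum-single (expansionTerm M) zero λ j →
    trans (signed-cong (toℕ (suc j)) (trans (*-congʳ (e (suc j) λ ())) (zeroˡ _))) (signed-0# (toℕ (suc j)))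

  det-addColumns : ∀ {m k} (M : Matrix m) (g : Fin k → Fin m) d → (∀ i → g i ≢ d) →
                   det (withColumn M d (λ r → M r d + sum (λ i → M r (g i)))) ≈ det M
  det-addColumns {k = zero}  M g d g≢d = det-cong (withColumn-self M d λ r → +-identityʳ _)
  det-addColumns {k = suc k} M g d g≢d = begin
    det (withColumn M d total)                                ≈⟨ det-cong (withColumn-cong M d regroup) ⟩
    det (withColumn M d (λ r → 1# * M′ r (g zero) + M′ r d))  ≈⟨ det-cong (withColumn-withColumn M d partial _) ⟨
    det (withColumn M′ d (λ r → 1# * M′ r (g zero) + M′ r d)) ≈⟨ det-addColumnMultiple M′ 1# (g≢d zero ∘ ≡.sym) ⟩
    det M′                                                    ≈⟨ det-addColumns M (g ∘ suc) d (g≢d ∘ suc) ⟩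
    det M                                                     ∎
    where
    total partial : Fin _ → Carrier
    total r = M r d + sum (λ i → M r (g i))
    partial r = M r d + sum (λ i → M r (g (suc i)))
    M′ : Matrix _
    M′ = withColumn M d partial
    regroup : ∀ r → total r ≈ 1# * M′ r (g zero) + M′ r d
    regroup r = begin
      M r d + (M r (g zero) + sum (λ i → M r (g (suc i))))  ≈⟨ solve 3 (λ a b c → a :+ (b :+ c) := con 1 :* b :+ (a :+ c)) refl _ _ _ ⟩
      1# * M r (g zero) + partial r                         ≡⟨ ≡.cong₂ (λ p q → 1# * p + q) (≡.sym (withColumn-off M partial r (g≢d zero)))
                                                                                         (≡.sym (withColumn-at M d partial r)) ⟩
      1# * M′ r (g zero) + M′ r d                           ∎

  addMultiplesOf : ∀ {m} → Fin m → (Fin m → Carrier) → Matrix m → Matrix m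
  addMultiplesOf e w M r x = w x * M r e + M r x

  addMultiplesOf-cong : ∀ {m} e {w w′ : Fin m → Carrier} M → (∀ x → w x ≈ w′ x) → addMultiplesOf e w M ≈ₘ addMultiplesOf e w′ M
  addMultiplesOf-cong e M ew r x = +-congʳ (*-congʳ (ew x))

  addMultiplesOf-zero : ∀ {m} e {w : Fin m → Carrier} M → (∀ x → w x ≈ 0#) → addMultiplesOf e w M ≈ₘ M
  addMultiplesOf-zero e M w≈0 r x = trans (+-congʳ (trans (*-congʳ (w≈0 x)) (zeroˡ _))) (+-identityˡ _)

  det-addColumnMultiplesBelow : ∀ k {m} (M : Matrix m) e (w : Fin m → Carrier) → w e ≈ 0# →
                                (∀ x → k ℕ.≤ toℕ x → w x ≈ 0#) → det (addMultiplesOf e w M) ≈ det M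
  det-addColumnMultiplesBelow zero    M e w we≈0 w≈0 = det-cong (addMultiplesOf-zero e M λ x → w≈0 x z≤n)
  det-addColumnMultiplesBelow (suc k) {m} M e w we≈0 w≈0 with k ℕ.<? m
  ... | no k≮m  = det-addColumnMultiplesBelow k M e w we≈0 λ x k≤x → ⊥-elim (k≮m (ℕ.≤-<-trans k≤x (toℕ<n x)))
  ... | yes k<m = step (fromℕ< k<m) (toℕ-fromℕ< k<m)
    where
    step : ∀ xₖ → toℕ xₖ ≡ k → det (addMultiplesOf e w M) ≈ det M
    step xₖ xₖ≡k = begin
      det (addMultiplesOf e w M) ≈⟨ lastColumn (xₖ ≟ e) ⟩
      det N′                     ≈⟨ det-addColumnMultiplesBelow k M e w′ w′e≈0 w′≈0 ⟩
      det M                      ∎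
      where
      w′ : Fin m → Carrier
      w′ = updateAt w xₖ λ _ → 0#
      N′ : Matrix m
      N′ = addMultiplesOf e w′ M
      w′-off : ∀ {x} → x ≢ xₖ → w′ x ≡ w x
      w′-off {x} x≢xₖ = updateAt-minimal x xₖ w x≢xₖ
      w′≈0 : ∀ x → k ℕ.≤ toℕ x → w′ x ≈ 0#
      w′≈0 x k≤x with x ≟ xₖ
      ... | yes ≡.refl = reflexive (updateAt-updates x w)
      ... | no x≢xₖ    = trans (reflexive (w′-off x≢xₖ))
                               (w≈0 x (ℕ.≤∧≢⇒< k≤x λ eq → x≢xₖ (toℕ-injective (≡.trans (≡.sym eq) (≡.sym xₖ≡k)))))
      w′e≈0 : w′ e ≈ 0#
      w′e≈0 with e ≟ xₖ
      ... | yes ≡.refl = reflexive (updateAt-updates e w)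
      ... | no e≢xₖ    = trans (reflexive (w′-off e≢xₖ)) we≈0
      lastColumn : Dec (xₖ ≡ e) → det (addMultiplesOf e w M) ≈ det N′
      lastColumn (yes ≡.refl) = det-cong (addMultiplesOf-cong e M λ x → w≈w′ x (x ≟ xₖ))
        where
        w≈w′ : ∀ x → Dec (x ≡ xₖ) → w x ≈ w′ x
        w≈w′ x (yes ≡.refl) = trans we≈0 (sym w′e≈0)
        w≈w′ x (no x≢xₖ)    = reflexive (≡.sym (w′-off x≢xₖ))
      lastColumn (no xₖ≢e) = begin
        det (addMultiplesOf e w M)   ≈⟨ det-cong columnwise ⟩
        det (withColumn N′ xₖ added) ≈⟨ det-addColumnMultiple N′ (w xₖ) xₖ≢e ⟩
        det N′                       ∎
        where
        added : Fin m → Carrier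
        added r = w xₖ * N′ r e + N′ r xₖ
        columnwise : addMultiplesOf e w M ≈ₘ withColumn N′ xₖ added
        columnwise r x with x ≟ xₖ
        ... | yes ≡.refl = sym (trans (reflexive (withColumn-at N′ x added r)) (+-cong
                (*-congˡ (trans (+-congʳ (trans (*-congʳ w′e≈0) (zeroˡ _))) (+-identityˡ _)))
                (trans (+-congʳ (trans (*-congʳ (reflexive (updateAt-updates x w))) (zeroˡ _))) (+-identityˡ _))))
        ... | no x≢xₖ    = sym (trans (reflexive (withColumn-off N′ added r x≢xₖ)) (+-congʳ (*-congʳ (reflexive (w′-off x≢xₖ)))))

  det-addColumnMultiples : ∀ {m} (M : Matrix m) e (w : Fin m → Carrier) → w e ≈ 0# → det (addMultiplesOf e w M) ≈ det M
  det-addColumnMultiples {m} M e w we≈0 = det-addColumnMultiplesBelow m M e w we≈0 λ x m≤x → ⊥-elim (ℕ.<⇒≱ (toℕ<n x) m≤x)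

  -- Adding all columns to column 0 makes it constant; clearing row 0 with it leaves the reduced matrix.
  det-constantRowSums : ∀ {m} (M : Matrix (suc m)) s → (∀ r → sum (M r) ≈ s) →
                        det M ≈ s * det (λ r x → M (suc r) (suc x) - M zero (suc x))
  det-constantRowSums {m} M s rowSum = begin
    det M                                         ≈⟨ det-addColumns M suc zero (λ _ ()) ⟨
    det (withColumn M zero (λ r → sum (M r)))     ≈⟨ det-cong (withColumn-cong M zero λ r → trans (rowSum r) (sym (*-identityʳ s))) ⟩
    det (withColumn M zero (λ _ → s * 1#))        ≈⟨ det-scaleColumn M zero s (λ _ → 1#) ⟩
    s * det N                                     ≈⟨ *-congˡ (det-addColumnMultiples N zero w refl) ⟨
    s * det N′                                    ≈⟨ *-congˡ (det-row0 N′ row0) ⟩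
    s * (N′ zero zero * det (minor zero N′))
      ≈⟨ *-congˡ (*-cong corner (det-cong reduced)) ⟩
    s * (1# * det (λ r x → M (suc r) (suc x) - M zero (suc x)))
      ≈⟨ *-congˡ (*-identityˡ _) ⟩
    s * det (λ r x → M (suc r) (suc x) - M zero (suc x)) ∎
    where
    N : Matrix (suc m)
    N = withColumn M zero λ _ → 1#
    w : Fin (suc m) → Carrier
    w zero    = 0#
    w (suc x) = - M zero (suc x)
    N′ : Matrix (suc m)
    N′ = addMultiplesOf zero w N
    N-zero : ∀ r → N r zero ≡ 1#
    N-zero r = withColumn-at M zero (λ _ → 1#) r
    N-suc : ∀ r x → N r (suc x) ≡ M r (suc x)
    N-suc r x = withColumn-off M {zero} (λ _ → 1#) r λ ()
    N′-suc : ∀ r x → N′ r (suc x) ≈ M r (suc x) - M zero (suc x)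
    N′-suc r x = trans (+-cong (trans (*-congˡ (reflexive (N-zero r))) (*-identityʳ _)) (reflexive (N-suc r x)))
                       (+-comm _ _)
    row0 : ∀ j → j ≢ zero → N′ zero j ≈ 0#
    row0 zero    0≢0 = ⊥-elim (0≢0 ≡.refl)
    row0 (suc x) _   = trans (N′-suc zero x) (-‿inverseʳ _)
    corner : N′ zero zero ≈ 1#
    corner = trans (+-congʳ (zeroˡ _)) (trans (+-identityˡ _) (reflexive (N-zero zero)))
    reduced : minor zero N′ ≈ₘ (λ r x → M (suc r) (suc x) - M zero (suc x))
    reduced r x = N′-suc (suc r) x

  signed-parity : ∀ {k l} → k ≡ l ⊎ 2 ℕ.+ k ≡ l → ∀ x → signed k x ≈ signed l x
  signed-parity         (inj₁ k≡l)   x = signed-≡ k≡l x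
  signed-parity {k = k} (inj₂ 2+k≡l) x = trans (sym (signed-2+ k x)) (signed-≡ 2+k≡l x)

  signed-punchIn-punchIn : ∀ {n} p (q : Fin (suc (suc n))) (c q′ : Fin (suc n)) → punchIn (punchIn q c) q′ ≡ q → ∀ z →
                           signed (toℕ (punchIn q c)) (signed (p ℕ.+ toℕ q′) z) ≈ signed (suc p ℕ.+ toℕ q) (signed (toℕ c) z)
  signed-punchIn-punchIn p q c q′ eq z = trans (signed-signed (toℕ (punchIn q c)) _ z)
    (trans (signed-parity (Sum.map (shift 0) (shift 2) (punchIn-punchIn-parity q c q′ eq)) z)
           (sym (signed-signed (suc p ℕ.+ toℕ q) (toℕ c) z)))
    where
    rearrange : ∀ t j p q′ → t ℕ.+ (j ℕ.+ (p ℕ.+ q′)) ≡ p ℕ.+ (t ℕ.+ (j ℕ.+ q′))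
    rearrange = solve-∀
    regroup : ∀ p q c → p ℕ.+ suc (q ℕ.+ c) ≡ suc p ℕ.+ q ℕ.+ c
    regroup = solve-∀
    shift : ∀ t → t ℕ.+ (toℕ (punchIn q c) ℕ.+ toℕ q′) ≡ suc (toℕ q ℕ.+ toℕ c) →
            t ℕ.+ (toℕ (punchIn q c) ℕ.+ (p ℕ.+ toℕ q′)) ≡ suc p ℕ.+ toℕ q ℕ.+ toℕ c
    shift t e = ≡.trans (rearrange t _ p (toℕ q′)) (≡.trans (≡.cong (p ℕ.+_) e) (regroup p (toℕ q) (toℕ c)))

  minorAt : ∀ {m} → Fin (suc m) → Fin (suc m) → Matrix (suc m) → Matrix m
  minorAt p q M r x = M (punchIn p r) (punchIn q x)

  det-expandColumn : ∀ {m} (M : Matrix (suc m)) p q a → (∀ r → r ≢ p → M r q ≈ 0#) → M p q ≈ a →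
                     det M ≈ signed (toℕ p ℕ.+ toℕ q) (a * det (minorAt p q M))
  det-expandColumn M zero q a others Mpq≈a = trans (sum-single (expansionTerm M) q vanishing)
    (signed-cong (toℕ q) (*-congʳ Mpq≈a))
    where
    vanishing : ∀ i → expansionTerm M (punchIn q i) ≈ 0#
    vanishing i = trans (signed-cong (toℕ (punchIn q i)) (trans (*-congˡ (det-zeroColumn (minor (punchIn q i) M) (punchOut j≢q) λ r →
                           trans (reflexive (minor-punchOut M j≢q r)) (others (suc r) λ ()))) (zeroʳ _))) (signed-0# (toℕ (punchIn q i)))
      where
      j≢q : punchIn q i ≢ q
      j≢q = punchInᵢ≢i q i
  det-expandColumn {suc m} M (suc p) q a others Mpq≈a = begin
    det M                                                          ≈⟨ sum-remove {i = q} (expansionTerm M) ⟩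
    expansionTerm M q + sum (λ c → expansionTerm M (punchIn q c))  ≈⟨ +-congʳ qTerm≈0 ⟩
    0# + sum (λ c → expansionTerm M (punchIn q c))                 ≈⟨ +-identityˡ _ ⟩
    sum (λ c → expansionTerm M (punchIn q c))                      ≈⟨ sum-cong-≋ termwise ⟩
    sum (λ c → signed K (a * expansionTerm A c))                   ≈⟨ sum-signed K (λ c → a * expansionTerm A c) ⟩
    signed K (sum (λ c → a * expansionTerm A c))                   ≈⟨ signed-cong K (*-distribˡ-sum a (expansionTerm A)) ⟨
    signed K (a * det A)                                           ∎
    where
    K : ℕ
    K = suc (toℕ p) ℕ.+ toℕ q
    A : Matrix (suc m)
    A = minorAt (suc p) q M
    qTerm≈0 : expansionTerm M q ≈ 0#
    qTerm≈0 = trans (signed-cong (toℕ q) (trans (*-congʳ (others zero λ ())) (zeroˡ _))) (signed-0# (toℕ q))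
    termwise : ∀ c → expansionTerm M (punchIn q c) ≈ signed K (a * expansionTerm A c)
    termwise c = begin
      signed (toℕ j) (x * det (minor j M))                  ≈⟨ signed-cong (toℕ j) (*-congˡ (det-expandColumn (minor j M) p q′ a others′ entry)) ⟩
      signed (toℕ j) (x * signed (toℕ p ℕ.+ toℕ q′) (a * det (minorAt p q′ (minor j M))))
        ≈⟨ signed-cong (toℕ j) (*-congˡ (signed-cong (toℕ p ℕ.+ toℕ q′) (*-congˡ (det-cong minors)))) ⟩
      signed (toℕ j) (x * signed (toℕ p ℕ.+ toℕ q′) (a * D)) ≈⟨ signed-cong (toℕ j) (signed-* (toℕ p ℕ.+ toℕ q′) x (a * D)) ⟨
      signed (toℕ j) (signed (toℕ p ℕ.+ toℕ q′) (x * (a * D))) ≈⟨ signed-punchIn-punchIn (toℕ p) q c q′ (punchIn-punchOut j≢q) _ ⟩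
      signed K (signed (toℕ c) (x * (a * D)))
        ≈⟨ signed-cong K (signed-cong (toℕ c) (solve 3 (λ x a D → x :* (a :* D) := a :* (x :* D)) refl x a D)) ⟩
      signed K (signed (toℕ c) (a * (x * D)))               ≈⟨ signed-cong K (signed-* (toℕ c) a _) ⟩
      signed K (a * expansionTerm A c)                      ∎
      where
      j : Fin (suc (suc m))
      j = punchIn q c
      j≢q : j ≢ q
      j≢q = punchInᵢ≢i q c
      q′ : Fin (suc m)
      q′ = punchOut j≢q
      x D : Carrier
      x = M zero j
      D = det (minor c A)
      others′ : ∀ r → r ≢ p → minor j M r q′ ≈ 0#
      others′ r r≢p = trans (reflexive (minor-punchOut M j≢q r)) (others (suc r) (r≢p ∘ suc-injective))
      entry : minor j M p q′ ≈ a
      entry = trans (reflexive (minor-punchOut M j≢q p)) Mpq≈a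
      minors : minorAt p q′ (minor j M) ≈ₘ minor c A
      minors r y = reflexive (≡.cong (M (suc (punchIn p r))) (punchIn-punchIn q c q′ y (punchIn-punchOut j≢q)))

  module _ {h : Carrier → Carrier} (isHom : RingMorphisms.IsRingHomomorphism rawRing rawRing h) where
    open RingMorphisms.IsRingHomomorphism isHom

    signed-homo : ∀ k x → h (signed k x) ≈ signed k (h x)
    signed-homo zero    x = refl
    signed-homo (suc k) x = trans (-‿homo _) (-‿cong (signed-homo k x))

    sum-homo : ∀ {n} (f : Fin n → Carrier) → h (sum f) ≈ sum (λ i → h (f i))
    sum-homo {zero}  f = 0#-homo
    sum-homo {suc n} f = trans (+-homo _ _) (+-congˡ (sum-homo (λ i → f (suc i))))

    det-homo : ∀ {m} (M : Matrix m) → h (det M) ≈ det (λ r x → h (M r x))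
    det-homo {zero}  M = 1#-homo
    det-homo {suc m} M = trans (sum-homo (expansionTerm M)) (sum-cong-≋ λ j →
      trans (signed-homo (toℕ j) _) (signed-cong (toℕ j) (trans (*-homo (M zero j) _) (*-congˡ (det-homo (minor j M))))))

  labelled : ∀ {k} → (ℕ → ℕ → Carrier) → (ℕ → ℕ) → Matrix k
  labelled F g i j = F (g (toℕ i)) (g (toℕ j))

  detOn : (ℕ → ℕ → Carrier) → List ℕ → Carrier
  detOn F xs = det (labelled {length xs} F (nth xs))

  DiagonalColumn : (ℕ → ℕ → Carrier) → Carrier → ℕ → Set ℓ
  DiagonalColumn F a u = F u u ≈ a × (∀ r → r ≢ u → F r u ≈ 0#)

  detOn-removeVertex : ∀ F a pre u ws → AllPairs _≢_ (pre ++ u ∷ ws) → DiagonalColumn F a u →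
                       detOn F (pre ++ u ∷ ws) ≈ a * detOn F (pre ++ ws)
  detOn-removeVertex F a pre u ws distinct (diagonal , offDiagonal) = begin
    detOn F (pre ++ u ∷ ws)                         ≡⟨ ≡.cong (λ n → det (labelled {n} F g)) (length-middle pre u ws) ⟩
    det M                                           ≈⟨ det-expandColumn M p p a offDiagonal′ diagonal′ ⟩
    signed (toℕ p ℕ.+ toℕ p) (a * det (minorAt p p M)) ≈⟨ signed-double (toℕ p) _ ⟩
    a * det (minorAt p p M)                         ≈⟨ *-congˡ (det-cong λ i j → reflexive (≡.cong₂ F (g-punchIn i) (g-punchIn j))) ⟩
    a * detOn F (pre ++ ws)                         ∎
    where
    k : ℕ
    k = length (pre ++ ws)
    g : ℕ → ℕ
    g = nth (pre ++ u ∷ ws)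
    M : Matrix (suc k)
    M = labelled F g
    pre≤k : length pre ℕ.≤ k
    pre≤k = ℕ.≤-trans (ℕ.m≤m+n (length pre) (length ws)) (ℕ.≤-reflexive (≡.sym (length-++ pre)))
    p : Fin (suc k)
    p = fromℕ< (s≤s pre≤k)
    g-p : g (toℕ p) ≡ u
    g-p = ≡.trans (≡.cong g (toℕ-fromℕ< (s≤s pre≤k))) (nth-middle pre u ws)
    diagonal′ : M p p ≈ a
    diagonal′ = trans (reflexive (≡.cong₂ F g-p g-p)) diagonal
    <length : ∀ (i : Fin (suc k)) → toℕ i ℕ.< length (pre ++ u ∷ ws)
    <length i = ℕ.<-≤-trans (toℕ<n i) (ℕ.≤-reflexive (≡.sym (length-middle pre u ws)))
    offDiagonal′ : ∀ r → r ≢ p → M r p ≈ 0#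
    offDiagonal′ r r≢p = trans (reflexive (≡.cong (F (g (toℕ r))) g-p)) (offDiagonal (g (toℕ r)) λ eq →
      r≢p (toℕ-injective (nth-injective distinct (<length r) (<length p) (≡.trans eq (≡.sym g-p)))))
    g-punchIn : ∀ i → g (toℕ (punchIn p i)) ≡ nth (pre ++ ws) (toℕ i)
    g-punchIn i with toℕ-punchIn p i
    ... | inj₁ (i<p , eq) = ≡.trans (≡.cong g eq) (nth-beforeMiddle pre u ws (ℕ.<-≤-trans i<p (ℕ.≤-reflexive (toℕ-fromℕ< (s≤s pre≤k)))))
    ... | inj₂ (p≤i , eq) = ≡.trans (≡.cong g eq) (nth-afterMiddle pre u ws (ℕ.≤-trans (ℕ.≤-reflexive (≡.sym (toℕ-fromℕ< (s≤s pre≤k)))) p≤i))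

  detOn-removeVertices : ∀ F (P : ℕ → Bool) a pre ws → AllPairs _≢_ (pre ++ ws) →
                         All (λ u → P u ≡ true → DiagonalColumn F a u) ws →
                         detOn F (pre ++ ws) ≈ a ^ count P ws * detOn F (pre ++ filterᵇ (not ∘ P) ws)
  detOn-removeVertices F P a pre []       distinct []                 = sym (*-identityˡ _)
  detOn-removeVertices F P a pre (u ∷ ws) distinct (diagonalᵤ ∷ diagonals) with P u
  ... | true  = begin
    detOn F (pre ++ u ∷ ws)                       ≈⟨ detOn-removeVertex F a pre u ws distinct (diagonalᵤ ≡.refl) ⟩
    a * detOn F (pre ++ ws)                       ≈⟨ *-congˡ (detOn-removeVertices F P a pre ws (AllPairs-removeMiddle pre ws distinct) diagonals) ⟩
    a * (a ^ count P ws * detOn F (pre ++ rest))  ≈⟨ *-assoc a _ _ ⟨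
    a * a ^ count P ws * detOn F (pre ++ rest)    ∎
    where
    rest : List ℕ
    rest = filterᵇ (not ∘ P) ws
  ... | false = begin
    detOn F (pre ++ u ∷ ws)                               ≡⟨ ≡.cong (detOn F) (++-assoc pre (u ∷ []) ws) ⟨
    detOn F ((pre ++ u ∷ []) ++ ws)                       ≈⟨ detOn-removeVertices F P a (pre ++ u ∷ []) ws
                                                               (≡.subst (AllPairs _≢_) (≡.sym (++-assoc pre (u ∷ []) ws)) distinct) diagonals ⟩
    a ^ count P ws * detOn F ((pre ++ u ∷ []) ++ rest)    ≡⟨ ≡.cong (λ xs → a ^ count P ws * detOn F xs) (++-assoc pre (u ∷ []) rest) ⟩
    a ^ count P ws * detOn F (pre ++ u ∷ rest)            ∎
    where
    rest : List ℕ
    rest = filterᵇ (not ∘ P) ws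

module IdealSum (m : ℕ) where
  open import Defs using (idealSumIsWhole)
  open import Data.Nat using (ℕ; suc; _+_; _*_; _%_; _<_; _≤_; z≤n; s≤s; _≡ᵇ_)
  import Data.Nat.Properties as ℕ
  open import Data.Nat.DivMod using (m<n⇒m%n≡m; [m+kn]%n≡m%n; m%n<n; %-distribˡ-*; m%n%n≡m%n; m≡m%n+[m/n]*n; _/_)
  open import Data.Nat.Divisibility using (_∣_; ∣-trans; ∣1⇒≡1; ∣m+n∣m⇒∣n; n∣m*n)
  open import Data.Nat.GCD using (gcd; gcd[m,n]∣m; gcd[m,n]∣n)
  open import Data.Nat.Coprimality using (gcd≡1⇒coprime; coprime-Bézout)
  import Data.Nat.GCD as GCD
  open import Data.Nat.Tactic.RingSolver using (solve-∀)
  open import Data.Bool using (true; false)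
  open import Data.Bool.ListAction using (any)
  open import Data.List using (upTo)
  open import Data.Product using (∃; _×_; _,_)
  open import Relation.Binary.PropositionalEquality

  private
    n : ℕ
    n = suc m

  unit-inverse : ∀ {u} → gcd u n ≡ 1 → ∃ λ b → (b * u) % n ≡ 1 % n
  unit-inverse {u} g with coprime-Bézout (gcd≡1⇒coprime {u} {n} g)
  ... | GCD.Bézout.+- x y eq = x , (begin
    (x * u) % n      ≡⟨ cong (_% n) eq ⟨
    (1 + y * n) % n  ≡⟨ [m+kn]%n≡m%n 1 y n ⟩
    1 % n            ∎)
    where open ≡-Reasoning
  -- Here 1 + x u = y n, hence x m u + y n = 1 + x u n and x m inverts u.
  ... | GCD.Bézout.-+ x y eq = x * m , (begin
    (x * m * u) % n            ≡⟨ [m+kn]%n≡m%n (x * m * u) y n ⟨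
    (x * m * u + y * n) % n    ≡⟨ cong (λ z → (x * m * u + z) % n) eq ⟨
    (x * m * u + (1 + x * u)) % n ≡⟨ cong (_% n) (regroup x m u) ⟩
    (1 + x * u * n) % n        ≡⟨ [m+kn]%n≡m%n 1 (x * u) n ⟩
    1 % n                      ∎)
    where
    open ≡-Reasoning
    regroup : ∀ x m u → x * m * u + (1 + x * u) ≡ 1 + x * u * suc m
    regroup = solve-∀

  unit-inverse< : ∀ {u} → gcd u n ≡ 1 → ∃ λ b → b < n × (b * u) % n ≡ 1 % n
  unit-inverse< {u} g with unit-inverse g
  ... | b , inverse = b % n , m%n<n b n , (begin
    (b % n * u) % n             ≡⟨ %-distribˡ-* (b % n) u n ⟩
    (b % n % n * (u % n)) % n   ≡⟨ cong (λ z → (z * (u % n)) % n) (m%n%n≡m%n b n) ⟩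
    (b % n * (u % n)) % n       ≡⟨ %-distribˡ-* b u n ⟨
    (b * u) % n                 ≡⟨ inverse ⟩
    1 % n                       ∎)
    where open ≡-Reasoning

  idealSumIsWhole-unitʳ : ∀ {u} → gcd u n ≡ 1 → ∀ x → idealSumIsWhole m x u ≡ true
  idealSumIsWhole-unitʳ {u} g x with unit-inverse< g
  ... | b , b<n , inverse = any-upTo (λ a → any (λ b → ((a * x + b * u) % n) ≡ᵇ (1 % n)) (upTo n)) {n} (s≤s z≤n)
                              (any-upTo (λ b → ((0 * x + b * u) % n) ≡ᵇ (1 % n)) b<n
    (trans (cong (_≡ᵇ 1 % n) inverse) (≡ᵇ-refl (1 % n))))

  idealSumIsWhole-unitˡ : ∀ {u} → gcd u n ≡ 1 → ∀ x → idealSumIsWhole m u x ≡ true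
  idealSumIsWhole-unitˡ {u} g x with unit-inverse< g
  ... | b , b<n , inverse = any-upTo (λ a → any (λ b → ((a * u + b * x) % n) ≡ᵇ (1 % n)) (upTo n)) {n} b<n
                              (any-upTo (λ c → ((b * u + c * x) % n) ≡ᵇ (1 % n)) {n} (s≤s z≤n)
    (trans (cong (λ z → (z % n) ≡ᵇ 1 % n) (ℕ.+-identityʳ (b * u))) (trans (cong (_≡ᵇ 1 % n) inverse) (≡ᵇ-refl (1 % n)))))

  nonunit-noInverse : 1 ≤ m → ∀ {r} → gcd r n ≢ 1 → ∀ b → (b * r) % n ≢ 1 % n
  nonunit-noInverse 1≤m {r} g≢1 b inverse = g≢1 (∣1⇒≡1 (∣m+n∣m⇒∣n ∣q*n+1 (∣-trans (gcd[m,n]∣n r n) (n∣m*n q))))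
    where
    open ≡-Reasoning
    q : ℕ
    q = (b * r) / n
    b*r≡1+q*n : b * r ≡ 1 + q * n
    b*r≡1+q*n = begin
      b * r               ≡⟨ m≡m%n+[m/n]*n (b * r) n ⟩
      (b * r) % n + q * n ≡⟨ cong (_+ q * n) (trans inverse (m<n⇒m%n≡m (s≤s 1≤m))) ⟩
      1 + q * n           ∎
    ∣q*n+1 : gcd r n ∣ q * n + 1
    ∣q*n+1 = subst (gcd r n ∣_) (trans b*r≡1+q*n (ℕ.+-comm 1 _)) (∣-trans (gcd[m,n]∣m r n) (n∣m*n b))

  idealSumIsWhole-nonunitʳ : 1 ≤ m → ∀ {r} → gcd r n ≢ 1 → idealSumIsWhole m 0 r ≡ false
  idealSumIsWhole-nonunitʳ 1≤m {r} g≢1 = any-none _ (upTo n) λ a → any-none _ (upTo n) λ b →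
    ≢⇒≡ᵇ-false λ eq → nonunit-noInverse 1≤m g≢1 b (trans (cong (λ z → (z + b * r) % n) (sym (ℕ.*-zeroʳ a))) eq)

  idealSumIsWhole-nonunitˡ : 1 ≤ m → ∀ {r} → gcd r n ≢ 1 → idealSumIsWhole m r 0 ≡ false
  idealSumIsWhole-nonunitˡ 1≤m {r} g≢1 = any-none _ (upTo n) λ a → any-none _ (upTo n) λ b →
    ≢⇒≡ᵇ-false λ eq → nonunit-noInverse 1≤m g≢1 a
      (trans (cong (_% n) (sym (trans (cong (a * r +_) (ℕ.*-zeroʳ b)) (ℕ.+-identityʳ _)))) eq)

open import Defs
open import Algebra.Bundles using (RawRing)
open import Data.Nat as ℕ using (zero; suc; _<_; _≤_; _>_; z≤n; s≤s; _≡ᵇ_)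
import Data.Nat.Properties as ℕ
open import Data.Nat.GCD using (gcd; gcd-greatest)
open import Data.Nat.Divisibility using (_∣_; ∣-refl; ∣1⇒≡1)
open import Data.Integer using (+_; -_)
open import Data.Fin as Fin using (Fin; zero; suc; toℕ)
open import Data.Fin.Properties using (toℕ<n; punchInᵢ≢i; toℕ-injective)
open import Data.Bool using (Bool; true; false; not; _∧_; if_then_else_)
open import Data.Bool.Properties using (∧-identityʳ; T-not-≡)
open import Data.List using (List; []; _∷_; _∷ʳ_; map; length; lookup; filterᵇ; upTo; applyUpTo)
open import Data.List.Properties using (map-upTo; applyUpTo-∷ʳ; lookup-applyUpTo)
import Data.List.Relation.Unary.All as All
import Data.List.Relation.Unary.All.Properties as AllP
open import Data.List.Relation.Unary.AllPairs using (AllPairs)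
import Data.List.Relation.Unary.AllPairs.Properties as AllPairsP
open import Data.Product using (_,_)
open import Function using (_∘_; Equivalence; case_of_)
open import Relation.Nullary.Decidable using (T?)
open import Relation.Binary.PropositionalEquality as ≡ using (_≡_; _≢_)

module P = Determinant PolyRing
open CommutativeRing PolyRing using (setoid; +-assoc; +-identityʳ; -‿inverseˡ; -‿inverseʳ)
open import Algebra.Properties.Ring (CommutativeRing.ring PolyRing) using (-‿+-comm; -‿involutive)
open import Algebra.Properties.Semiring.Sum (CommutativeRing.semiring PolyRing) using (sum; ∑-distrib-+)

open import Algebra.Definitions.RawSemiring (RawRing.rawSemiring (CommutativeRing.rawRing PolyRing)) using (_^_)

^≡^P : ∀ p k → p ^ k ≡ p ^P k
^≡^P p zero    = ≡.refl
^≡^P p (suc k) = ≡.cong (p *P_) (^≡^P p k)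

sign·P≋signed : ∀ k p → sign k ·P p ≋ P.signed k p
sign·P≋signed zero          p = ·P-identityˡ p
sign·P≋signed (suc zero)    p = ≋-refl
sign·P≋signed (suc (suc k)) p = ≋-trans (sign·P≋signed k p) (≋-sym (-‿involutive _))

sumFin≋sum : ∀ m {f g : Fin m → Poly} → (∀ i → f i ≋ g i) → sumFin m f ≋ sum g
sumFin≋sum zero    f≋g = ≋-refl
sumFin≋sum (suc m) f≋g = +P-cong (f≋g zero) (sumFin≋sum m (λ i → f≋g (suc i)))

det≋ : ∀ m M → det m M ≋ P.det M
det≋ zero    M = ≋-refl
det≋ (suc m) M = sumFin≋sum (suc m) λ j →
  ≋-trans (sign·P≋signed (toℕ j) _) (P.signed-cong (toℕ j) (*P-cong (≋-refl {M zero j}) (det≋ m (P.minor j M))))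

laplacianEntry : Bool → ℕ → Bool → Poly
laplacianEntry diagonal degree adjacent =
  ((if diagonal then X else []) -P (if diagonal then constP (+ degree) else [])) +P (if adjacent then constP (+ 1) else [])

laplacianMatrix : (vs : List ℕ) → (ℕ → ℕ → Bool) → P.Matrix (length vs)
laplacianMatrix vs adj i j =
  laplacianEntry (toℕ i ≡ᵇ toℕ j) (count (adj (lookup vs i)) vs) (adj (lookup vs i) (lookup vs j))

lapCharPoly≋det : ∀ vs adj → lapCharPoly vs adj ≋ P.det (laplacianMatrix vs adj)
lapCharPoly≋det vs adj = det≋ (length vs) _

sum-δ : ∀ {m} (i : Fin m) p {f : Fin m → Poly} → (∀ j → f j ≋ (if toℕ i ≡ᵇ toℕ j then p else [])) → sum f ≋ p
sum-δ {suc m} i p {f} f≋δ = ≋-trans (P.sum-single f i λ k → ≋-trans (f≋δ (Fin.punchIn i k))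
    (≋-reflexive (≡.cong (λ b → if b then p else []) (≢⇒≡ᵇ-false λ eq → punchInᵢ≢i i k (toℕ-injective (≡.sym eq))))))
  (≋-trans (f≋δ i) (≋-reflexive (≡.cong (λ b → if b then p else []) (≡ᵇ-refl (toℕ i)))))

sum-indicator : ∀ (Q : ℕ → Bool) xs → sum (λ j → if Q (lookup xs j) then constP (+ 1) else []) ≋ constP (+ count Q xs)
sum-indicator Q []       = ≋-sym x·-[]
sum-indicator Q (x ∷ xs) with Q x
... | true  = +P-cong ≋-refl (sum-indicator Q xs)
... | false = sum-indicator Q xs

negP-if : ∀ b p → negP (if b then p else []) ≡ (if b then negP p else [])
negP-if true  p = ≡.refl
negP-if false p = ≡.refl

laplacianMatrix-rowSum : ∀ vs adj i → sum (laplacianMatrix vs adj i) ≋ X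
laplacianMatrix-rowSum vs adj i = begin
  sum (laplacianMatrix vs adj i)                              ≈⟨ ∑-distrib-+ (λ j → δ j X -P δ j c) adjacency ⟩
  sum (λ j → δ j X -P δ j c) +P sum adjacency                 ≈⟨ +P-cong (∑-distrib-+ (λ j → δ j X) (λ j → negP (δ j c))) (sum-indicator (adj v) vs) ⟩
  (sum (λ j → δ j X) +P sum (λ j → negP (δ j c))) +P c        ≈⟨ +P-cong (+P-cong (sum-δ i X λ _ → ≋-refl)
                                                                   (sum-δ i (negP c) λ j → ≋-reflexive (negP-if (toℕ i ≡ᵇ toℕ j) c))) (≋-refl {c}) ⟩
  (X +P negP c) +P c                                          ≈⟨ +-assoc X (negP c) c ⟩
  X +P (negP c +P c)                                          ≈⟨ +P-cong (≋-refl {X}) (-‿inverseˡ c) ⟩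
  X +P []                                                     ≈⟨ +-identityʳ X ⟩
  X                                                           ∎
  where
  open import Relation.Binary.Reasoning.Setoid setoid
  v : ℕ
  v = lookup vs i
  c : Poly
  c = constP (+ count (adj v) vs)
  δ : Fin (length vs) → Poly → Poly
  δ j p = if toℕ i ≡ᵇ toℕ j then p else []
  adjacency : Fin (length vs) → Poly
  adjacency j = if adj v (lookup vs j) then constP (+ 1) else []

laplacianEntry-shift : ∀ diagonal k d adjacent →
                       laplacianEntry diagonal (k ℕ.+ d) adjacent ≋ laplacianEntry diagonal d adjacent ∘P (X -P constP (+ k))
laplacianEntry-shift true k d adjacent = begin
  (X -P (ck +P cd)) +P A                    ≈⟨ +P-cong (+P-cong (≋-refl {X}) (-‿+-comm ck cd)) (≋-refl {A}) ⟨
  (X +P (negP ck +P negP cd)) +P A          ≈⟨ +P-cong (+-assoc X (negP ck) (negP cd)) (shift-invariant adjacent) ⟨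
  (s -P cd) +P A ∘P s                       ≈⟨ +P-cong (+P-cong (∘P-X s) (≋-trans (∘P-negP cd s) (·P-cong (- + 1) (∘P-constP (+ d) s))))
                                                        (≋-refl {A ∘P s}) ⟨
  (X ∘P s +P negP cd ∘P s) +P A ∘P s        ≈⟨ +P-cong (∘P-+P X (negP cd) s) (≋-refl {A ∘P s}) ⟨
  (X -P cd) ∘P s +P A ∘P s                  ≈⟨ ∘P-+P (X -P cd) A s ⟨
  ((X -P cd) +P A) ∘P s                     ∎
  where
  open import Relation.Binary.Reasoning.Setoid setoid
  ck cd s A : Poly
  ck = constP (+ k)
  cd = constP (+ d)
  s = X -P ck
  A = if adjacent then constP (+ 1) else []
  shift-invariant : ∀ adjacent → (if adjacent then constP (+ 1) else []) ∘P s ≋ (if adjacent then constP (+ 1) else [])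
  shift-invariant true  = ∘P-constP (+ 1) s
  shift-invariant false = ≋-refl
laplacianEntry-shift false k d true  = ≋-sym (∘P-constP (+ 1) (X -P constP (+ k)))
laplacianEntry-shift false k d false = ≋-refl

module ComaximalGraph (m : ℕ) (1≤m : 1 ≤ m) where
  open IdealSum m

  n : ℕ
  n = suc m

  adj : ℕ → ℕ → Bool
  adj = comaximalAdj n

  isUnit : ℕ → Bool
  isUnit x = gcd x n ≡ᵇ 1

  degree : ℕ → ℕ
  degree r = count (adj r) (upTo n)

  G : ℕ → ℕ → Poly
  G r j = laplacianEntry (r ≡ᵇ j) (degree r) (adj r j)

  H : ℕ → ℕ → Poly
  H r j = G r j -P G 0 j

  nonzero : List ℕ
  nonzero = applyUpTo suc m

  adj-irreflexive : ∀ u → adj u u ≡ false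
  adj-irreflexive u = ≡.cong (λ b → not b ∧ idealSumIsWhole m u u) (≡ᵇ-refl u)

  adj-unit : ∀ {r u} → r ≢ u → gcd u n ≡ 1 → adj r u ≡ true
  adj-unit {r} {u} r≢u g = ≡.cong₂ (λ b c → not b ∧ c) (≢⇒≡ᵇ-false r≢u) (idealSumIsWhole-unitʳ g r)

  adj-nonunitˡ : ∀ {a} → 1 ≤ a → gcd a n ≢ 1 → adj a 0 ≡ false
  adj-nonunitˡ {suc a} _ g≢1 = ≡.cong (true ∧_) (idealSumIsWhole-nonunitˡ 1≤m g≢1)

  adj-nonunitʳ : ∀ {a} → 1 ≤ a → gcd a n ≢ 1 → adj 0 a ≡ false
  adj-nonunitʳ {suc a} _ g≢1 = ≡.cong (true ∧_) (idealSumIsWhole-nonunitʳ 1≤m g≢1)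

  degree-unit : ∀ {u} → u < n → gcd u n ≡ 1 → degree u ≡ m
  degree-unit {u} u<n g = ≡.trans (count-cong (All.universal (λ w →
    ≡.trans (≡.cong (not (u ≡ᵇ w) ∧_) (idealSumIsWhole-unitˡ g w)) (∧-identityʳ _)) (upTo n))) (count-≢-upTo m u<n)

  isUnit-n : isUnit n ≡ false
  isUnit-n = ≢⇒≡ᵇ-false λ gcd[n,n]≡1 →
    ℕ.<⇒≢ (s≤s 1≤m) (≡.sym (∣1⇒≡1 (≡.subst (n ∣_) gcd[n,n]≡1 (gcd-greatest ∣-refl ∣-refl))))

  φ≡count : φ n ≡ count isUnit nonzero
  φ≡count = begin
    count isUnit (map suc (upTo n))        ≡⟨ ≡.cong (count isUnit) (map-upTo suc n) ⟩
    count isUnit (applyUpTo suc n)                   ≡⟨ ≡.cong (count isUnit) (applyUpTo-∷ʳ suc m) ⟨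
    count isUnit (nonzero ∷ʳ n)                      ≡⟨ count-++ isUnit nonzero (n ∷ []) ⟩
    count isUnit nonzero ℕ.+ count isUnit (n ∷ [])   ≡⟨ ≡.cong (λ b → count isUnit nonzero ℕ.+ count (λ _ → b) (n ∷ [])) isUnit-n ⟩
    count isUnit nonzero ℕ.+ 0                       ≡⟨ ℕ.+-identityʳ _ ⟩
    count isUnit nonzero                             ∎
    where open ≡.≡-Reasoning

  vertsG₂≡nonunits : vertsG₂ n ≡ filterᵇ (not ∘ isUnit) nonzero
  vertsG₂≡nonunits = filterᵇ-cong (AllP.applyUpTo⁺₁ suc m λ _ → ≡.refl)

  nonunits-positive : All.All (1 ≤_) (vertsG₂ n)
  nonunits-positive = ≡.subst (All.All (1 ≤_)) (≡.sym vertsG₂≡nonunits)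
    (AllP.filter⁺ (T? ∘ not ∘ isUnit) (AllP.applyUpTo⁺₁ suc m λ _ → s≤s z≤n))

  nonunits-nonunit : All.All (λ a → isUnit a ≡ false) (vertsG₂ n)
  nonunits-nonunit = ≡.subst (All.All (λ a → isUnit a ≡ false)) (≡.sym vertsG₂≡nonunits)
    (All.map (Equivalence.to T-not-≡) (AllP.all-filter (T? ∘ not ∘ isUnit) nonzero))

  degree-nonunit : ∀ {a} → 1 ≤ a → isUnit a ≡ false → degree a ≡ φ n ℕ.+ count (adj a) (vertsG₂ n)
  degree-nonunit {a} 1≤a ¬unit = begin
    count (adj a) (0 ∷ nonzero)
      ≡⟨ ≡.cong (λ b → if b then suc (count (adj a) nonzero) else count (adj a) nonzero) (adj-nonunitˡ 1≤a (≡ᵇ-false⇒≢ ¬unit)) ⟩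
    count (adj a) nonzero
      ≡⟨ count-partition (adj a) isUnit nonzero ⟩
    count (adj a) (filterᵇ isUnit nonzero) ℕ.+ count (adj a) (filterᵇ (not ∘ isUnit) nonzero)
      ≡⟨ ≡.cong₂ ℕ._+_ (count-filter (adj a) isUnit nonzero (All.universal unitsAdjacent nonzero))
                       (≡.cong (count (adj a)) (≡.sym vertsG₂≡nonunits)) ⟩
    count isUnit nonzero ℕ.+ count (adj a) (vertsG₂ n)
      ≡⟨ ≡.cong (ℕ._+ count (adj a) (vertsG₂ n)) φ≡count ⟨
    φ n ℕ.+ count (adj a) (vertsG₂ n) ∎
    where
    open ≡.≡-Reasoning
    unitsAdjacent : ∀ x → isUnit x ≡ true → adj a x ≡ true
    unitsAdjacent x unit = adj-unit (λ { ≡.refl → case ≡.trans (≡.sym ¬unit) unit of λ () }) (≡ᵇ-true⇒≡ unit)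

  G≡ : ∀ {r j b d a} → (r ≡ᵇ j) ≡ b → degree r ≡ d → adj r j ≡ a → G r j ≡ laplacianEntry b d a
  G≡ ≡.refl ≡.refl ≡.refl = ≡.refl

  unitColumn : ∀ {u} → 1 ≤ u → u < n → gcd u n ≡ 1 → P.DiagonalColumn H (X -P constP (+ n)) u
  unitColumn {u} 1≤u u<n g = diagonal , offDiagonal
    where
    0≢u : 0 ≢ u
    0≢u = ℕ.<⇒≢ 1≤u
    G0u : G 0 u ≡ constP (+ 1)
    G0u = G≡ (≢⇒≡ᵇ-false 0≢u) ≡.refl (adj-unit 0≢u g)
    diagonal : H u u ≋ X -P constP (+ n)
    diagonal = begin
      G u u -P G 0 u                                      ≡⟨ ≡.cong₂ _-P_ (G≡ (≡ᵇ-refl u) (degree-unit u<n g) (adj-irreflexive u)) G0u ⟩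
      ((X -P constP (+ m)) +P []) -P constP (+ 1)         ≈⟨ +P-cong (+-identityʳ (X -P constP (+ m))) (≋-refl {negP (constP (+ 1))}) ⟩
      (X -P constP (+ m)) -P constP (+ 1)                 ≈⟨ +-assoc X (negP (constP (+ m))) (negP (constP (+ 1))) ⟩
      X +P (negP (constP (+ m)) +P negP (constP (+ 1)))   ≈⟨ +P-cong (≋-refl {X}) (-‿+-comm (constP (+ m)) (constP (+ 1))) ⟩
      X -P constP (+ (m ℕ.+ 1))                           ≡⟨ ≡.cong (λ k → X -P constP (+ k)) (ℕ.+-comm m 1) ⟩
      X -P constP (+ n)                                   ∎
      where open import Relation.Binary.Reasoning.Setoid setoid
    offDiagonal : ∀ r → r ≢ u → H r u ≋ []
    offDiagonal r r≢u = ≋-trans (≋-reflexive (≡.cong₂ _-P_ (G≡ (≢⇒≡ᵇ-false r≢u) ≡.refl (adj-unit r≢u g)) G0u))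
                                (-‿inverseʳ (constP (+ 1)))

  nth-nonzero : ∀ (i : Fin (length nonzero)) → nth nonzero (toℕ i) ≡ suc (toℕ i)
  nth-nonzero i = ≡.trans (≡.sym (lookup≡nth nonzero i)) (lookup-applyUpTo suc m i)

  nonzero-distinct : AllPairs _≢_ nonzero
  nonzero-distinct = AllPairsP.applyUpTo⁺₁ suc m λ i<j _ → ℕ.<⇒≢ (s≤s i<j)

  detΓ≋X*detOn : μΓ n ≋ X *P P.detOn H nonzero
  detΓ≋X*detOn = begin
    μΓ n                                                       ≈⟨ lapCharPoly≋det (upTo n) adj ⟩
    P.det L                                                    ≈⟨ P.det-constantRowSums L X (laplacianMatrix-rowSum (upTo n) adj) ⟩
    X *P P.det (λ r c → L (suc r) (suc c) -P L zero (suc c))   ≈⟨ *P-cong (≋-refl {X}) (P.det-cong λ r c → ≋-reflexive (reduced r c)) ⟩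
    X *P P.detOn H nonzero                                     ∎
    where
    open import Relation.Binary.Reasoning.Setoid setoid
    L : P.Matrix (length (upTo n))
    L = laplacianMatrix (upTo n) adj
    reduced : ∀ r c → L (suc r) (suc c) -P L zero (suc c) ≡ H (nth nonzero (toℕ r)) (nth nonzero (toℕ c))
    reduced r c rewrite nth-nonzero r | nth-nonzero c | lookup-applyUpTo suc m r | lookup-applyUpTo suc m c = ≡.refl

  detOn-units : P.detOn H nonzero ≋ (X -P constP (+ n)) ^P φ n *P P.detOn H (vertsG₂ n)
  detOn-units = ≋-trans (P.detOn-removeVertices H isUnit (X -P constP (+ n)) [] nonzero nonzero-distinct unitColumns)
    (≋-reflexive (≡.cong₂ (λ a vs → a *P P.detOn H vs)
      (≡.trans (^≡^P (X -P constP (+ n)) (count isUnit nonzero)) (≡.cong ((X -P constP (+ n)) ^P_) (≡.sym φ≡count))) (≡.sym vertsG₂≡nonunits)))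
    where
    unitColumns : All.All (λ u → isUnit u ≡ true → P.DiagonalColumn H (X -P constP (+ n)) u) nonzero
    unitColumns = AllP.applyUpTo⁺₁ suc m λ k<m unit → unitColumn (s≤s z≤n) (s≤s k<m) (≡ᵇ-true⇒≡ unit)

  detOn-nonunits : P.detOn H (vertsG₂ n) ≋ μG₂ n ∘P (X -P constP (+ φ n))
  detOn-nonunits = begin
    P.detOn H V₂                                ≈⟨ P.det-cong entries ⟩
    P.det (λ i j → laplacianMatrix V₂ adj i j ∘P s) ≈⟨ P.det-homo (∘P-isRingHomomorphism s) (laplacianMatrix V₂ adj) ⟨
    P.det (laplacianMatrix V₂ adj) ∘P s         ≈⟨ ∘P-congˡ s (lapCharPoly≋det V₂ adj) ⟨
    μG₂ n ∘P s                                  ∎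
    where
    open import Relation.Binary.Reasoning.Setoid setoid
    V₂ : List ℕ
    V₂ = vertsG₂ n
    s : Poly
    s = X -P constP (+ φ n)
    distinct : AllPairs _≢_ V₂
    distinct = ≡.subst (AllPairs _≢_) (≡.sym vertsG₂≡nonunits) (AllPairsP.filter⁺ (T? ∘ not ∘ isUnit) nonzero-distinct)
    entries : ∀ i j → H (nth V₂ (toℕ i)) (nth V₂ (toℕ j)) ≋ laplacianMatrix V₂ adj i j ∘P s
    entries i j = begin
      G a b -P G 0 b           ≡⟨ ≡.cong (G a b -P_) (G≡ (≢⇒≡ᵇ-false (ℕ.<⇒≢ 1≤b)) ≡.refl (adj-nonunitʳ 1≤b (≡ᵇ-false⇒≢ b-nonunit))) ⟩
      G a b +P negP []         ≈⟨ +-identityʳ (G a b) ⟩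
      G a b                    ≡⟨ G≡ (nth-≡ᵇ distinct (toℕ<n i) (toℕ<n j)) (degree-nonunit 1≤a a-nonunit) ≡.refl ⟩
      laplacianEntry (toℕ i ≡ᵇ toℕ j) (φ n ℕ.+ count (adj a) V₂) (adj a b) ≈⟨ laplacianEntry-shift (toℕ i ≡ᵇ toℕ j) (φ n) _ (adj a b) ⟩
      laplacianEntry (toℕ i ≡ᵇ toℕ j) (count (adj a) V₂) (adj a b) ∘P s
        ≡⟨ ≡.cong₂ (λ x y → laplacianEntry (toℕ i ≡ᵇ toℕ j) (count (adj x) V₂) (adj x y) ∘P s) (lookup≡nth V₂ i) (lookup≡nth V₂ j) ⟨
      laplacianMatrix V₂ adj i j ∘P s ∎
      where
      a b : ℕ
      a = nth V₂ (toℕ i)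
      b = nth V₂ (toℕ j)
      1≤a : 1 ≤ a
      1≤a = All-nth nonunits-positive (toℕ<n i)
      1≤b : 1 ≤ b
      1≤b = All-nth nonunits-positive (toℕ<n j)
      a-nonunit : isUnit a ≡ false
      a-nonunit = All-nth nonunits-nonunit (toℕ<n i)
      b-nonunit : isUnit b ≡ false
      b-nonunit = All-nth nonunits-nonunit (toℕ<n j)

  μΓ-factorisation : μΓ n ≋ (X *P ((X -P constP (+ n)) ^P φ n)) *P (μG₂ n ∘P (X -P constP (+ φ n)))
  μΓ-factorisation = begin
    μΓ n                                                  ≈⟨ detΓ≋X*detOn ⟩
    X *P P.detOn H nonzero                                ≈⟨ *P-cong (≋-refl {X}) detOn-units ⟩
    X *P (xn^φ *P P.detOn H (vertsG₂ n))                  ≈⟨ *P-cong (≋-refl {X}) (*P-cong (≋-refl {xn^φ}) detOn-nonunits) ⟩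
    X *P (xn^φ *P (μG₂ n ∘P (X -P constP (+ φ n))))       ≈⟨ *P-assoc X xn^φ _ ⟨
    (X *P xn^φ) *P (μG₂ n ∘P (X -P constP (+ φ n)))       ∎
    where
    open import Relation.Binary.Reasoning.Setoid setoid
    xn^φ : Poly
    xn^φ = (X -P constP (+ n)) ^P φ n

theorem3p3 : (n : ℕ) → n > 2 →
    μΓ n ≈P (X *P ((X -P constP (+ n)) ^P φ n))
              *P (μG₂ n ∘P (X -P constP (+ φ n)))
theorem3p3 (suc m) (s≤s 2≤m) = ≋⇒≈P (ComaximalGraph.μΓ-factorisation m (ℕ.≤-trans (s≤s z≤n) 2≤m))
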